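{- For every formula $\psi$ of $BT$: if $BT^{cl}\vdash\psi$, then $BT\vdash\psi^-$.
   Context: $BT$ is the many-typed applicative theory with intuitionistic logic defined as follows. Types $\omega$ and $k\geqslant0$ ($\omega$ smallest). Variables: numerical $m,n,\ldots$ (type $\omega$), $X^k,Y^k,Z^k,\ldots$ of type $k$; type-$0$ variables also written $x,y,z,f,g,u,v$. Constants: $0$ (numerical), type-0 constants $\underline{k},\underline{s},\underline{d},\underline{p},\underline{p}_1,\underline{p}_2,\underline{c}_n$ $(n\geqslant0)$. No function symbols. Predicates: $Ap(f,x,y)$, $x=_{0\omega}m$, $x=_{0k}Y^k$, $X^k\in_kY^{k+1}$. Formulas built from atomic ones and $\bot$ by $\wedge,\vee,\supset,\forall,\exists$; $\neg\varphi:=\varphi\supset\bot$. A formula is $n$-elementary if it contains only types $\leqslant n$, no quantifier over type-$n$ variables and no $=_{0n}$. External terms: constants, variables, and applications $t\tau$ (left-associated). $t\simeq x$ is $x=_{0s}t$ for $t$ a constant/variable of type $s$, and $\exists y,z(t_1\simeq y\wedge t_2\simeq z\wedge Ap(y,z,x))$ for $t=t_1t_2$; $t\downarrow:=\exists x(t\simeq x)$, $t\simeq\tau:=\exists x(t\simeq x\wedge\tau\simeq x)$, $t\cong\tau:=\forall x(t\simeq x\equiv\tau\simeq x)$; $\tau(t_1,\ldots,t_n)$ means $\tau\langle t_1,\ldots,t_n\rangle$ with $\langle x_1\rangle=x_1$, $\langle x_1,\ldots,x_{n+1}\rangle=\underline{p}\langle x_1,\ldots,x_n\rangle x_{n+1}$.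 Axioms: (1) intuitionistic logic; (2) equality: $x=_{00}x$; $u=_{0k}X^k\wedge v=_{0k}X\wedge u=_{0n}Y^n\supset v=_{0n}Y$; $u=_{0\omega}m\wedge v=_{0\omega}m\supset u=_{00}v$; $u=_{0\omega}m\wedge u=_{00}v\supset v=_{0\omega}m$; $Ap(f,x,y)\wedge f=_{00}g\wedge x=_{00}u\wedge y=_{00}v\supset Ap(g,u,v)$; $X^k\in_kY^{k+1}\wedge X^k=_kU^k\wedge Y^{k+1}=_{k+1}Z^{k+1}\supset U\in_kZ$; (3) combinatorial: $Ap(f,x,y)\wedge Ap(f,x,z)\supset y=z$; $\underline{k}xy\simeq x$; $\underline{s}xy\downarrow$; $\underline{s}xyz\cong xz(yz)$; $\underline{p}xy\downarrow$; $\neg(\underline{p}xy\simeq0)$; $\underline{p}_ix\downarrow$; $\underline{p}_i(\underline{p}x_1x_2)\simeq x_i$; $\exists m(\underline{p}n0\simeq m)$; $\exists Z^k(\underline{p}xY^k\simeq Z)$; $n=m\supset\underline{d}xynm\simeq x$; $n\neq m\supset\underline{d}xynm\simeq y$; $\exists x(x=_{0\omega}n)$; $\exists x(x=_{0k}Y^k)$; (4) induction rule: from $\varphi[n/0]$ and $\varphi\supset\exists m(\underline{p}n0\simeq m\wedge\varphi[n/m])$ infer $\varphi$; (5) comprehension: $\exists U^{k+1}[\underline{c}_n(\widetilde X)\simeq U\wedge\forall Z^k(Z\in_kU\equiv\varphi)]$ for $\widetilde X$ a list of variables of types $\leqslant k+1$, $\varphi$ $(k+1)$-elementary with parameters among $Z^k,\widetilde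 X$, and $n$ the Gödel number of $Z^k.\widetilde X.\varphi$. $BT^{cl}$ is $BT$ with classical logic. Negative translation $^-$ (defined by simultaneous induction on Gödel numbers): for every constant $a$ other than a comprehension constant, $a^-:=a$. For a comprehension constant $\underline{c}_n$: if $n=\llcorner Z^k.\widetilde X.\varphi\lrcorner$ then $\underline{c}_n^-:=\underline{c}_{n^- }$ with $n^-:=\llcorner Z^k.\widetilde X.\varphi^-\lrcorner$; otherwise $\underline{c}_n^-:=0$. For formulas: if $\varphi$ is atomic, $\varphi^-:=\neg\neg\tilde\varphi$ where $\tilde\varphi$ replaces each constant $a$ by $a^-$; $\bot^-:=\bot$; $(\psi\wedge\chi)^-:=\psi^-\wedge\chi^-$; $(\psi\supset\chi)^-:=\psi^-\supset\chi^-$; $(\psi\vee\chi)^-:=\neg\neg(\psi^-\vee\chi^-)$; $(\forall X\psi)^-:=\forall X\psi^-$; $(\exists X\psi)^-:=\neg\neg\exists X\psi^-$ for a variable $X$ of any type. -}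

module Defs where

open import Data.Nat using (ℕ; zero; suc; _+_; _*_; _≤ᵇ_; _<ᵇ_; _≡ᵇ_; _⊔_; _/_; _%_)
import Data.Nat as Nat
open import Data.Bool using (Bool; true; false; if_then_else_; _∧_; _∨_; not)
open import Data.List using (List; []; _∷_; _++_; length; concatMap; replicate; map)
open import Data.Maybe using (Maybe; just; nothing; _>>=_)
open import Data.Product using (_×_; _,_)
open import Data.Sum using (_⊎_)
open import Relation.Binary.PropositionalEquality using (_≡_; refl)
open import Relation.Nullary using (Dec; yes; no; ¬_)

data Ty : Set where
  ω  : Ty
  ty : ℕ → Ty

_≟T_ : (s t : Ty) → Dec (s ≡ t)
ω ≟T ω = yes refl
ω ≟T ty _ = no (λ ())
ty _ ≟T ω = no (λ ())
ty k ≟T ty l with k Nat.≟ l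
... | yes refl = yes refl
... | no k≢l = no (λ { refl → k≢l refl })

eqTy : Ty → Ty → Bool
eqTy ω ω = true
eqTy (ty k) (ty l) = k ≡ᵇ l
eqTy _ _ = false

_≤T_ : Ty → ℕ → Bool
ω ≤T n = true
ty k ≤T n = k ≤ᵇ n

_<T_ : Ty → ℕ → Bool
ω <T n = true
ty k <T n = k <ᵇ n

-- A variable of type s is  var i  at sort s
-- (i ∈ ℕ is its name; variables of different types are different).

data Const : Set where
  K S D P P₁ P₂ : Const
  C : ℕ → Const

data Term : Ty → Set where
  var : ∀ {s} → ℕ → Term s
  cst : Const → Term (ty 0)
  zer : Term ω

data Formula : Set where
  Ap   : Term (ty 0) → Term (ty 0) → Term (ty 0) → Formula
  EqN  : Term (ty 0) → Term ω → Formula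
  EqK  : (k : ℕ) → Term (ty 0) → Term (ty k) → Formula
  Mem  : (k : ℕ) → Term (ty k) → Term (ty (suc k)) → Formula
  ⊥f   : Formula
  _∧f_ : Formula → Formula → Formula
  _∨f_ : Formula → Formula → Formula
  _⇒_  : Formula → Formula → Formula
  All  : Ty → ℕ → Formula → Formula
  Ex   : Ty → ℕ → Formula → Formula

infixr 6 _∧f_
infixr 5 _∨f_
infixr 4 _⇒_

¬f_ : Formula → Formula
¬f φ = φ ⇒ ⊥f

_⇔_ : Formula → Formula → Formula
φ ⇔ ψ = (φ ⇒ ψ) ∧f (ψ ⇒ φ)

eqVar : Ty → ℕ → Ty → ℕ → Bool
eqVar s i s' j = eqTy s s' ∧ (i ≡ᵇ j)

termIs : (s : Ty) → ℕ → {s' : Ty} → Term s' → Bool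
termIs s i {s'} (var j) = eqVar s i s' j
termIs s i (cst _) = false
termIs s i zer = false

occursFree : Ty → ℕ → Formula → Bool
occursFree s i (Ap a b c) = termIs s i a ∨ termIs s i b ∨ termIs s i c
occursFree s i (EqN a b) = termIs s i a ∨ termIs s i b
occursFree s i (EqK k a b) = termIs s i a ∨ termIs s i b
occursFree s i (Mem k a b) = termIs s i a ∨ termIs s i b
occursFree s i ⊥f = false
occursFree s i (φ ∧f ψ) = occursFree s i φ ∨ occursFree s i ψ
occursFree s i (φ ∨f ψ) = occursFree s i φ ∨ occursFree s i ψ
occursFree s i (φ ⇒ ψ) = occursFree s i φ ∨ occursFree s i ψ
occursFree s i (All s' j φ) = not (eqVar s i s' j) ∧ occursFree s i φ
occursFree s i (Ex s' j φ) = not (eqVar s i s' j) ∧ occursFree s i φ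

substT : (s : Ty) → ℕ → Term s → {s' : Ty} → Term s' → Term s'
substT s i t {s'} (var j) with s ≟T s'
... | yes refl = if j ≡ᵇ i then t else var j
... | no _ = var j
substT s i t (cst a) = cst a
substT s i t zer = zer

sub : (s : Ty) → ℕ → Term s → Formula → Formula
sub s i t (Ap a b c) = Ap (substT s i t a) (substT s i t b) (substT s i t c)
sub s i t (EqN a b) = EqN (substT s i t a) (substT s i t b)
sub s i t (EqK k a b) = EqK k (substT s i t a) (substT s i t b)
sub s i t (Mem k a b) = Mem k (substT s i t a) (substT s i t b)
sub s i t ⊥f = ⊥f
sub s i t (φ ∧f ψ) = sub s i t φ ∧f sub s i t ψ
sub s i t (φ ∨f ψ) = sub s i t φ ∨f sub s i t ψ
sub s i t (φ ⇒ ψ) = sub s i t φ ⇒ sub s i t ψ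
sub s i t (All s' j φ) = if eqVar s i s' j then All s' j φ else All s' j (sub s i t φ)
sub s i t (Ex s' j φ) = if eqVar s i s' j then Ex s' j φ else Ex s' j (sub s i t φ)

freeFor : (s : Ty) → ℕ → Term s → Formula → Bool
freeFor s i t (φ ∧f ψ) = freeFor s i t φ ∧ freeFor s i t ψ
freeFor s i t (φ ∨f ψ) = freeFor s i t φ ∧ freeFor s i t ψ
freeFor s i t (φ ⇒ ψ) = freeFor s i t φ ∧ freeFor s i t ψ
freeFor s i t (All s' j φ) =
  eqVar s i s' j ∨ (not (occursFree s i φ ∧ termIs s' j t) ∧ freeFor s i t φ)
freeFor s i t (Ex s' j φ) =
  eqVar s i s' j ∨ (not (occursFree s i φ ∧ termIs s' j t) ∧ freeFor s i t φ)
freeFor s i t _ = true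

elementary : ℕ → Formula → Bool
elementary n (Ap a b c) = true
elementary n (EqN a b) = true
elementary n (EqK k a b) = k <ᵇ n
elementary n (Mem k a b) = suc k ≤ᵇ n
elementary n ⊥f = true
elementary n (φ ∧f ψ) = elementary n φ ∧ elementary n ψ
elementary n (φ ∨f ψ) = elementary n φ ∧ elementary n ψ
elementary n (φ ⇒ ψ) = elementary n φ ∧ elementary n ψ
elementary n (All s j φ) = (s <T n) ∧ elementary n φ
elementary n (Ex s j φ) = (s <T n) ∧ elementary n φ

data ETerm : Set where
  tm  : (s : Ty) → Term s → ETerm
  _·_ : ETerm → ETerm → ETerm

infixl 9 _·_

maxV0 : ETerm → ℕ
maxV0 (tm (ty zero) (var j)) = j
maxV0 (tm _ _) = 0
maxV0 (t · u) = maxV0 t ⊔ maxV0 u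

eqAtom : (s : Ty) → ℕ → Term s → Formula
eqAtom ω x t = EqN (var x) t
eqAtom (ty k) x t = EqK k (var x) t

_≃₀_ : ETerm → ℕ → Formula
tm s t ≃₀ x = eqAtom s x t
(t₁ · t₂) ≃₀ x =
  let y = suc (maxV0 (t₁ · t₂) ⊔ x) ; z = suc y in
  Ex (ty 0) y (Ex (ty 0) z ((t₁ ≃₀ y) ∧f (t₂ ≃₀ z) ∧f Ap (var y) (var z) (var x)))

fresh : ETerm → ETerm → ℕ
fresh t u = suc (maxV0 t ⊔ maxV0 u)

_↓ : ETerm → Formula
t ↓ = Ex (ty 0) (fresh t t) (t ≃₀ fresh t t)

isVar0 : ETerm → Maybe ℕ
isVar0 (tm (ty zero) (var j)) = just j
isVar0 _ = nothing

_≃_ : ETerm → ETerm → Formula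
t ≃ τ with isVar0 τ
... | just x = t ≃₀ x
... | nothing = Ex (ty 0) (fresh t τ) ((t ≃₀ fresh t τ) ∧f (τ ≃₀ fresh t τ))

_≅_ : ETerm → ETerm → Formula
t ≅ τ = All (ty 0) (fresh t τ) ((t ≃₀ fresh t τ) ⇔ (τ ≃₀ fresh t τ))

infix 3 _≃_ _≅_ _≃₀_

tuple : ETerm → List ETerm → ETerm
tuple a [] = a
tuple a (b ∷ r) = tuple (tm (ty 0) (cst P) · a · b) r

appArgs : ETerm → List ETerm → ETerm
appArgs τ [] = τ
appArgs τ (t ∷ ts) = τ · tuple t ts

-- Gödel numbering of  Z^k . X̃ . φ  (k, name of Z, list X̃, φ)

encTy : Ty → ℕ
encTy ω = 0
encTy (ty k) = suc k

decTy : ℕ → Ty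
decTy zero = ω
decTy (suc k) = ty k

encC : Const → List ℕ
encC K = 2 ∷ []
encC S = 3 ∷ []
encC D = 4 ∷ []
encC P = 5 ∷ []
encC P₁ = 6 ∷ []
encC P₂ = 7 ∷ []
encC (C m) = 8 ∷ m ∷ []

encT : ∀ {s} → Term s → List ℕ
encT (var i) = 0 ∷ i ∷ []
encT zer = 1 ∷ []
encT (cst a) = encC a

encF : Formula → List ℕ
encF (Ap a b c) = 0 ∷ encT a ++ encT b ++ encT c
encF (EqN a b) = 1 ∷ encT a ++ encT b
encF (EqK k a b) = 2 ∷ k ∷ encT a ++ encT b
encF (Mem k a b) = 3 ∷ k ∷ encT a ++ encT b
encF ⊥f = 4 ∷ []
encF (φ ∧f ψ) = 5 ∷ encF φ ++ encF ψ
encF (φ ∨f ψ) = 6 ∷ encF φ ++ encF ψ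
encF (φ ⇒ ψ) = 7 ∷ encF φ ++ encF ψ
encF (All s i φ) = 8 ∷ encTy s ∷ i ∷ encF φ
encF (Ex s i φ) = 9 ∷ encTy s ∷ i ∷ encF φ

encVars : List (Ty × ℕ) → List ℕ
encVars = concatMap (λ { (s , i) → encTy s ∷ i ∷ [] })

encTriple : ℕ → ℕ → List (Ty × ℕ) → Formula → List ℕ
encTriple k z xs φ = k ∷ z ∷ length xs ∷ encVars xs ++ encF φ

-- lists of naturals as naturals: a ↦ 1^a 0 , bits read with a leading 1
toBits : List ℕ → List Bool
toBits = concatMap (λ a → replicate a true ++ (false ∷ []))

num : List Bool → ℕ
num [] = 1
num (b ∷ bs) = (if b then 1 else 0) + 2 * num bs

code : ℕ → ℕ → List (Ty × ℕ) → Formula → ℕ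
code k z xs φ = num (toBits (encTriple k z xs φ))

bitsOf : ℕ → ℕ → List Bool
bitsOf zero _ = []
bitsOf (suc f) n = if n ≤ᵇ 1 then [] else ((n % 2 ≡ᵇ 1) ∷ bitsOf f (n / 2))

group : ℕ → List Bool → List ℕ
group a [] = []
group a (true ∷ bs) = group (suc a) bs
group a (false ∷ bs) = a ∷ group 0 bs

parseC : List ℕ → Maybe (Term (ty 0) × List ℕ)
parseC (2 ∷ r) = just (cst K , r)
parseC (3 ∷ r) = just (cst S , r)
parseC (4 ∷ r) = just (cst D , r)
parseC (5 ∷ r) = just (cst P , r)
parseC (6 ∷ r) = just (cst P₁ , r)
parseC (7 ∷ r) = just (cst P₂ , r)
parseC (8 ∷ m ∷ r) = just (cst (C m) , r)
parseC _ = nothing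

parseT : (s : Ty) → List ℕ → Maybe (Term s × List ℕ)
parseT s (0 ∷ i ∷ r) = just (var i , r)
parseT ω (1 ∷ r) = just (zer , r)
parseT ω _ = nothing
parseT (ty zero) r = parseC r
parseT (ty (suc k)) _ = nothing

parseF : ℕ → List ℕ → Maybe (Formula × List ℕ)
parseF zero _ = nothing
parseF (suc f) (0 ∷ r) =
  parseT (ty 0) r >>= λ { (a , r₁) → parseT (ty 0) r₁ >>= λ { (b , r₂) →
  parseT (ty 0) r₂ >>= λ { (c , r₃) → just (Ap a b c , r₃) } } }
parseF (suc f) (1 ∷ r) =
  parseT (ty 0) r >>= λ { (a , r₁) → parseT ω r₁ >>= λ { (b , r₂) →
  just (EqN a b , r₂) } }
parseF (suc f) (2 ∷ k ∷ r) =
  parseT (ty 0) r >>= λ { (a , r₁) → parseT (ty k) r₁ >>= λ { (b , r₂) →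
  just (EqK k a b , r₂) } }
parseF (suc f) (3 ∷ k ∷ r) =
  parseT (ty k) r >>= λ { (a , r₁) → parseT (ty (suc k)) r₁ >>= λ { (b , r₂) →
  just (Mem k a b , r₂) } }
parseF (suc f) (4 ∷ r) = just (⊥f , r)
parseF (suc f) (5 ∷ r) =
  parseF f r >>= λ { (φ , r₁) → parseF f r₁ >>= λ { (ψ , r₂) → just (φ ∧f ψ , r₂) } }
parseF (suc f) (6 ∷ r) =
  parseF f r >>= λ { (φ , r₁) → parseF f r₁ >>= λ { (ψ , r₂) → just (φ ∨f ψ , r₂) } }
parseF (suc f) (7 ∷ r) =
  parseF f r >>= λ { (φ , r₁) → parseF f r₁ >>= λ { (ψ , r₂) → just ((φ ⇒ ψ) , r₂) } }
parseF (suc f) (8 ∷ s ∷ i ∷ r) =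
  parseF f r >>= λ { (φ , r₁) → just (All (decTy s) i φ , r₁) }
parseF (suc f) (9 ∷ s ∷ i ∷ r) =
  parseF f r >>= λ { (φ , r₁) → just (Ex (decTy s) i φ , r₁) }
parseF (suc f) _ = nothing

parseVars : ℕ → List ℕ → Maybe (List (Ty × ℕ) × List ℕ)
parseVars zero r = just ([] , r)
parseVars (suc l) (s ∷ i ∷ r) =
  parseVars l r >>= λ { (xs , r₁) → just ((decTy s , i) ∷ xs , r₁) }
parseVars (suc l) _ = nothing

Triple : Set
Triple = ℕ × ℕ × List (Ty × ℕ) × Formula

parseTriple : List ℕ → Maybe Triple
parseTriple (k ∷ z ∷ l ∷ r) =
  parseVars l r >>= λ { (xs , r₁) → parseF (length r₁) r₁ >>= λ
    { (φ , []) → just (k , z , xs , φ)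
    ; (φ , _ ∷ _) → nothing } }
parseTriple _ = nothing

-- decode n = just (k , Z , X̃ , φ)  iff  n = ⌜Z^k.X̃.φ⌝  (checked explicitly)
decode : ℕ → Maybe Triple
decode n with parseTriple (group 0 (bitsOf n n))
... | nothing = nothing
... | just (k , z , xs , φ) = if code k z xs φ ≡ᵇ n then just (k , z , xs , φ) else nothing

trT : (ℕ → ℕ) → ∀ {s} → Term s → Term s
trT g (cst (C m)) = cst (C (g m))
trT g t = t

negF : (ℕ → ℕ) → Formula → Formula
negF g (Ap a b c) = ¬f ¬f Ap (trT g a) (trT g b) (trT g c)
negF g (EqN a b) = ¬f ¬f EqN (trT g a) (trT g b)
negF g (EqK k a b) = ¬f ¬f EqK k (trT g a) (trT g b)
negF g (Mem k a b) = ¬f ¬f Mem k (trT g a) (trT g b)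
negF g ⊥f = ⊥f
negF g (φ ∧f ψ) = negF g φ ∧f negF g ψ
negF g (φ ⇒ ψ) = negF g φ ⇒ negF g ψ
negF g (φ ∨f ψ) = ¬f ¬f (negF g φ ∨f negF g ψ)
negF g (All s i φ) = All s i (negF g φ)
negF g (Ex s i φ) = ¬f ¬f Ex s i (negF g φ)

-- n ↦ n^- (index of c_n^-), by recursion on Gödel numbers (with fuel;
-- every constant c_m occurring in a coded formula has m < its code).
-- If n is not a Gödel number, c_n^- := c_0.
negIdxF : ℕ → ℕ → ℕ
negIdxF zero n = 0
negIdxF (suc f) n with decode n
... | nothing = 0
... | just (k , z , xs , φ) = code k z xs (negF (negIdxF f) φ)

negIdx : ℕ → ℕ
negIdx n = negIdxF (suc n) n

neg : Formula → Formula
neg = negF negIdx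

-- Axioms of BT (with fixed variable names; instances are derivable)

v0 : ℕ → ETerm
v0 i = tm (ty 0) (var i)

xN yN zN fN gN uN vN : ℕ
xN = 0
yN = 1
zN = 2
fN = 3
gN = 4
uN = 5
vN = 6

nN mN : ℕ
nN = 0
mN = 1

XN YN ZN UN : ℕ
XN = 0
YN = 1
ZN = 2
UN = 3

ec : Const → ETerm
ec a = tm (ty 0) (cst a)

eN : ℕ → ETerm
eN i = tm ω (var i)

-- X^k =_k U^k  read as  X ≃ U
eqT : Ty → ℕ → ℕ → Formula
eqT s i j = tm s (var i) ≃ tm s (var j)

-- n = m  for numerical variables, read as  n ≃ m
_=ω_ : ℕ → ℕ → Formula
i =ω j = eN i ≃ eN j

memVar : Ty → ℕ → List (Ty × ℕ) → Bool
memVar s i [] = false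
memVar s i ((s' , j) ∷ xs) = eqVar s i s' j ∨ memVar s i xs

data Axiom : Formula → Set where
  eq-refl : Axiom (EqK 0 (var xN) (var xN))
  eq-sub  : ∀ k n → Axiom ((EqK k (var uN) (var XN) ∧f EqK k (var vN) (var XN)
                            ∧f EqK n (var uN) (var YN)) ⇒ EqK n (var vN) (var YN))
  eq-num₁ : Axiom ((EqN (var uN) (var mN) ∧f EqN (var vN) (var mN)) ⇒ EqK 0 (var uN) (var vN))
  eq-num₂ : Axiom ((EqN (var uN) (var mN) ∧f EqK 0 (var uN) (var vN)) ⇒ EqN (var vN) (var mN))
  eq-ap   : Axiom ((Ap (var fN) (var xN) (var yN) ∧f EqK 0 (var fN) (var gN)
                    ∧f EqK 0 (var xN) (var uN) ∧f EqK 0 (var yN) (var vN))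
                   ⇒ Ap (var gN) (var uN) (var vN))
  eq-mem  : ∀ k → Axiom ((Mem k (var XN) (var YN) ∧f eqT (ty k) XN UN
                          ∧f eqT (ty (suc k)) YN ZN) ⇒ Mem k (var UN) (var ZN))
  ap-fun  : Axiom ((Ap (var fN) (var xN) (var yN) ∧f Ap (var fN) (var xN) (var zN))
                   ⇒ EqK 0 (var yN) (var zN))
  k-ax    : Axiom (ec K · v0 xN · v0 yN ≃ v0 xN)
  s-def   : Axiom ((ec S · v0 xN · v0 yN) ↓)
  s-ax    : Axiom (ec S · v0 xN · v0 yN · v0 zN ≅ v0 xN · v0 zN · (v0 yN · v0 zN))
  p-def   : Axiom ((ec P · v0 xN · v0 yN) ↓)
  p-nz    : Axiom (¬f (ec P · v0 xN · v0 yN ≃ tm ω zer))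
  p₁-def  : Axiom ((ec P₁ · v0 xN) ↓)
  p₂-def  : Axiom ((ec P₂ · v0 xN) ↓)
  p₁-ax   : Axiom (ec P₁ · (ec P · v0 xN · v0 yN) ≃ v0 xN)
  p₂-ax   : Axiom (ec P₂ · (ec P · v0 xN · v0 yN) ≃ v0 yN)
  p-num   : Axiom (Ex ω mN (ec P · eN nN · tm ω zer ≃ eN mN))
  p-ty    : ∀ k → Axiom (Ex (ty k) ZN (ec P · v0 xN · tm (ty k) (var YN) ≃ tm (ty k) (var ZN)))
  d-eq    : Axiom ((nN =ω mN) ⇒ (ec D · v0 xN · v0 yN · eN nN · eN mN ≃ v0 xN))
  d-neq   : Axiom (¬f (nN =ω mN) ⇒ (ec D · v0 xN · v0 yN · eN nN · eN mN ≃ v0 yN))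
  num-rep : Axiom (Ex (ty 0) xN (EqN (var xN) (var nN)))
  ty-rep  : ∀ k → Axiom (Ex (ty 0) xN (EqK k (var xN) (var YN)))
  compr   : ∀ k z (xs : List (Ty × ℕ)) φ u →
            (∀ {s i} → memVar s i xs ≡ true → (s ≤T suc k) ≡ true) →
            elementary (suc k) φ ≡ true →
            (∀ s i → occursFree s i φ ≡ true →
                     eqVar s i (ty k) z ≡ true ⊎ memVar s i xs ≡ true) →
            memVar (ty (suc k)) u xs ≡ false →
            Axiom (Ex (ty (suc k)) u
                    ((appArgs (ec (C (code k z xs φ))) (map (λ { (s , i) → tm s (var i) }) xs)
                       ≃ tm (ty (suc k)) (var u))
                     ∧f All (ty k) z (Mem k (var z) (var u) ⇔ φ)))

data Logic : Set where
  int cla : Logic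

data Prf : Logic → Formula → Set where
  ax-K   : ∀ {L} φ ψ → Prf L (φ ⇒ ψ ⇒ φ)
  ax-S   : ∀ {L} φ ψ χ → Prf L ((φ ⇒ ψ) ⇒ (φ ⇒ ψ ⇒ χ) ⇒ φ ⇒ χ)
  ax-∧i  : ∀ {L} φ ψ → Prf L (φ ⇒ ψ ⇒ (φ ∧f ψ))
  ax-∧e₁ : ∀ {L} φ ψ → Prf L ((φ ∧f ψ) ⇒ φ)
  ax-∧e₂ : ∀ {L} φ ψ → Prf L ((φ ∧f ψ) ⇒ ψ)
  ax-∨i₁ : ∀ {L} φ ψ → Prf L (φ ⇒ (φ ∨f ψ))
  ax-∨i₂ : ∀ {L} φ ψ → Prf L (ψ ⇒ (φ ∨f ψ))
  ax-∨e  : ∀ {L} φ ψ χ → Prf L ((φ ⇒ χ) ⇒ (ψ ⇒ χ) ⇒ (φ ∨f ψ) ⇒ χ)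
  ax-efq : ∀ {L} φ → Prf L (⊥f ⇒ φ)
  ax-∀e  : ∀ {L} s i φ (t : Term s) → freeFor s i t φ ≡ true →
           Prf L (All s i φ ⇒ sub s i t φ)
  ax-∃i  : ∀ {L} s i φ (t : Term s) → freeFor s i t φ ≡ true →
           Prf L (sub s i t φ ⇒ Ex s i φ)
  mp     : ∀ {L φ ψ} → Prf L φ → Prf L (φ ⇒ ψ) → Prf L ψ
  ru-∀   : ∀ {L s i φ ψ} → occursFree s i ψ ≡ false →
           Prf L (ψ ⇒ φ) → Prf L (ψ ⇒ All s i φ)
  ru-∃   : ∀ {L s i φ ψ} → occursFree s i ψ ≡ false →
           Prf L (φ ⇒ ψ) → Prf L (Ex s i φ ⇒ ψ)
  ax-dne : ∀ φ → Prf cla (¬f ¬f φ ⇒ φ)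
  ax-BT  : ∀ {L φ} → Axiom φ → Prf L φ
  ru-ind : ∀ {L} n m φ → ¬ (n ≡ m) → occursFree ω m φ ≡ false →
           freeFor ω n (var m) φ ≡ true →
           Prf L (sub ω n zer φ) →
           Prf L (φ ⇒ Ex ω m ((ec P · eN n · tm ω zer ≃ eN m) ∧f sub ω n (var m) φ)) →
           Prf L φ

BT⊢_ : Formula → Set
BT⊢ φ = Prf int φ

BTcl⊢_ : Formula → Set
BTcl⊢ φ = Prf cla φ

-- The translation is pushed through BT^cl-derivations rule by rule.  Every
-- φ⁻ is ¬¬-stable, which accounts for classical logic and for ∃-elimination.
-- Most other axioms are positive formulas or implications between positive
-- formulas, and for positive ψ the translation ψ⁻ is intuitionistically
-- equivalent to ¬¬ψ.  The translated instance of comprehension for φ follows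
-- from the instance for φ⁻, as n⁻ = ⌜Z.X̃.φ⁻⌝: the recursion defining n ↦ n⁻
-- only visits the codes of constants inside φ, which are smaller than n.  For
-- the induction rule the translated step only gives ¬¬∃m (P n 0 ≃ m ∧ φ⁻[n := m]);
-- it becomes a genuine existential with the witness m′ = P n 0 from the axioms:
-- application is functional, so m and m′ are named by the same type-0 objects,
-- and φ⁻[n := m′] follows because it is stable.

module Submission where

open import Defs
open import Data.Bool using (Bool; true; false; _∨_; _∧_; not; if_then_else_)
open import Data.Bool.Properties
  using (∨-identityʳ; ∧-identityʳ; ∧-zeroʳ; ∨-conicalˡ; ∨-conicalʳ; ∧-conicalˡ; ∧-conicalʳ; T-≡)
open import Data.List using (List; []; _∷_; _++_; length; replicate; map)
open import Data.List.Membership.Propositional using (_∈_)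
open import Data.List.Membership.Propositional.Properties using (∈-++⁺ˡ; ∈-++⁺ʳ)
open import Data.List.Properties using (++-assoc; ++-identityʳ; length-++; length-replicate)
open import Data.List.Relation.Unary.Any using (here; there)
open import Data.Maybe using (just; nothing)
open import Data.Nat using (ℕ; zero; suc; _+_; _*_; _≤_; _<_; _⊔_; _≡ᵇ_; _≤ᵇ_; _/_; _%_; z≤n; s≤s)
import Data.Nat as ℕ
open import Data.Nat.DivMod using ([m+kn]%n≡m%n; m*n%n≡0; +-distrib-/; m*n/n≡m)
open import Data.Nat.Induction using (<-wellFounded)
open import Data.Nat.ListAction using (sum)
open import Data.Nat.Properties
open import Data.Product using (_×_; _,_)
open import Data.Unit using (⊤; tt)
open import Function.Base using (_∘_)
open import Function.Bundles using (Equivalence)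
open import Induction.WellFounded using (Acc; acc)
open import Relation.Binary.PropositionalEquality
  using (_≡_; _≢_; refl; sym; trans; cong; cong₂; subst; ≢-sym; module ≡-Reasoning)
open import Relation.Nullary using (yes; no; contradiction)

module Deduction (L : Logic) where

  infix 2 ⊢_ _⊩_

  ⊢_ : Formula → Set
  ⊢ φ = Prf L φ

  -- Γ ⊩ A : A follows from the hypothesis Γ, a left-nested conjunction whose
  -- last components are named v₀, v₁, … (de Bruijn style).
  _⊩_ : Formula → Formula → Set
  Γ ⊩ A = ⊢ Γ ⇒ A

  ⊤f : Formula
  ⊤f = ⊥f ⇒ ⊥f

  ⇒-refl : ∀ A → ⊢ A ⇒ A
  ⇒-refl A = mp (ax-K A (A ⇒ A)) (mp (ax-K A A) (ax-S A (A ⇒ A) A))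

  ⇒-trans : ∀ {A B X} → ⊢ A ⇒ B → ⊢ B ⇒ X → ⊢ A ⇒ X
  ⇒-trans {A} {B} {X} f g = mp (mp g (ax-K (B ⇒ X) A)) (mp f (ax-S A B X))

  pure : ∀ {Γ A} → ⊢ A → Γ ⊩ A
  pure {Γ} {A} p = mp p (ax-K A Γ)

  app : ∀ {Γ A B} → Γ ⊩ A ⇒ B → Γ ⊩ A → Γ ⊩ B
  app {Γ} {A} {B} f a = mp f (mp a (ax-S Γ A B))

  lam : ∀ {Γ A B} → Γ ∧f A ⊩ B → Γ ⊩ A ⇒ B
  lam {Γ} {A} {B} p =
    app (app (pure (ax-S A (Γ ∧f A) B)) (ax-∧i Γ A)) (pure (mp p (ax-K (Γ ∧f A ⇒ B) A)))

  close : ∀ {A} → ⊤f ⊩ A → ⊢ A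
  close p = mp (⇒-refl ⊥f) p

  fst : ∀ {Γ A B} → Γ ⊩ A ∧f B → Γ ⊩ A
  fst {A = A} {B} p = app (pure (ax-∧e₁ A B)) p

  snd : ∀ {Γ A B} → Γ ⊩ A ∧f B → Γ ⊩ B
  snd {A = A} {B} p = app (pure (ax-∧e₂ A B)) p

  pair : ∀ {Γ A B} → Γ ⊩ A → Γ ⊩ B → Γ ⊩ A ∧f B
  pair {A = A} {B} a b = app (app (pure (ax-∧i A B)) a) b

  wk : ∀ {Γ A B} → Γ ⊩ B → Γ ∧f A ⊩ B
  wk {Γ} {A} p = ⇒-trans (ax-∧e₁ Γ A) p

  v₀ : ∀ {Γ A} → Γ ∧f A ⊩ A
  v₀ {Γ} {A} = ax-∧e₂ Γ A

  v₁ : ∀ {Γ A B} → (Γ ∧f A) ∧f B ⊩ A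
  v₁ = wk v₀

  v₂ : ∀ {Γ A B X} → ((Γ ∧f A) ∧f B) ∧f X ⊩ A
  v₂ = wk v₁

  v₃ : ∀ {Γ A B X Y} → (((Γ ∧f A) ∧f B) ∧f X) ∧f Y ⊩ A
  v₃ = wk v₂

  inl : ∀ {Γ A B} → Γ ⊩ A → Γ ⊩ A ∨f B
  inl {A = A} {B} p = app (pure (ax-∨i₁ A B)) p

  inr : ∀ {Γ A B} → Γ ⊩ B → Γ ⊩ A ∨f B
  inr {A = A} {B} p = app (pure (ax-∨i₂ A B)) p

  case∨ : ∀ {Γ A B X} → Γ ⊩ A ∨f B → Γ ∧f A ⊩ X → Γ ∧f B ⊩ X → Γ ⊩ X
  case∨ {A = A} {B} {X} p l r = app (app (app (pure (ax-∨e A B X)) (lam l)) (lam r)) p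

  ∀E : ∀ {Γ s i A} (t : Term s) → freeFor s i t A ≡ true → Γ ⊩ All s i A → Γ ⊩ sub s i t A
  ∀E {s = s} {i} {A} t t-free p = app (pure (ax-∀e s i A t t-free)) p

  ∃I : ∀ {Γ s i A} (t : Term s) → freeFor s i t A ≡ true → Γ ⊩ sub s i t A → Γ ⊩ Ex s i A
  ∃I {s = s} {i} {A} t t-free p = app (pure (ax-∃i s i A t t-free)) p

  ∃E : ∀ {Γ s i A X} → occursFree s i Γ ≡ false → occursFree s i X ≡ false →
       Γ ⊩ Ex s i A → Γ ∧f A ⊩ X → Γ ⊩ X
  ∃E {Γ} {A = A} {X} i∉Γ i∉X p q =
    app (app (pure (ru-∃ (cong₂ _∨_ i∉Γ i∉X) swapped)) p) (⇒-refl Γ)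
    where
    swapped : ⊢ A ⇒ Γ ⇒ X
    swapped = lam (⇒-trans (pair v₀ (wk (⇒-refl A))) q)

  gen : ∀ {A} s i → ⊢ A → ⊢ All s i A
  gen s i p = close (ru-∀ refl (pure p))

  inst : ∀ {A} s i (t : Term s) → freeFor s i t A ≡ true → ⊢ A → ⊢ sub s i t A
  inst s i t t-free p = close (∀E t t-free (pure (gen s i p)))

  ¬¬I : ∀ {Γ A} → Γ ⊩ A → Γ ⊩ ¬f ¬f A
  ¬¬I p = lam (app v₀ (wk p))

  Stable : Formula → Set
  Stable A = ⊢ ¬f ¬f A ⇒ A

  ¬¬E : ∀ {Γ A B} → Stable B → Γ ⊩ ¬f ¬f A → Γ ∧f A ⊩ B → Γ ⊩ B
  ¬¬E B-stable p q =
    app (pure B-stable) (lam (app (wk p) (lam (app v₁ (⇒-trans (pair (wk (wk (⇒-refl _))) v₀) q)))))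

  ¬-stable : ∀ {A} → Stable (¬f A)
  ¬-stable = close (lam (lam (app v₁ (lam (app v₀ v₁)))))

  ¬¬bind : ∀ {Γ A B} → Γ ⊩ ¬f ¬f A → Γ ∧f A ⊩ ¬f ¬f B → Γ ⊩ ¬f ¬f B
  ¬¬bind = ¬¬E ¬-stable

  ⊥-stable : Stable ⊥f
  ⊥-stable = close (lam (app v₀ (lam v₀)))

  ∧-stable : ∀ {A B} → Stable A → Stable B → Stable (A ∧f B)
  ∧-stable A-stable B-stable =
    close (lam (pair (app (pure A-stable) (lam (app v₁ (lam (app v₁ (fst v₀))))))
                     (app (pure B-stable) (lam (app v₁ (lam (app v₁ (snd v₀))))))))

  ⇒-stable : ∀ {A B} → Stable B → Stable (A ⇒ B)
  ⇒-stable B-stable = close (lam (lam (app (pure B-stable) (lam (app v₂ (lam (app v₁ (app v₀ v₂))))))))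

open Deduction int

-- Variables and substitution

≡ᵇ-refl : ∀ n → (n ≡ᵇ n) ≡ true
≡ᵇ-refl n = Equivalence.to T-≡ (≡⇒≡ᵇ n n refl)

≡ᵇ-sym : ∀ m n → (m ≡ᵇ n) ≡ (n ≡ᵇ m)
≡ᵇ-sym zero zero = refl
≡ᵇ-sym zero (suc n) = refl
≡ᵇ-sym (suc m) zero = refl
≡ᵇ-sym (suc m) (suc n) = ≡ᵇ-sym m n

≡ᵇ-true⇒≡ : ∀ m n → (m ≡ᵇ n) ≡ true → m ≡ n
≡ᵇ-true⇒≡ m n e = ≡ᵇ⇒≡ m n (Equivalence.from T-≡ e)

≢⇒≡ᵇ-false : ∀ m n → m ≢ n → (m ≡ᵇ n) ≡ false
≢⇒≡ᵇ-false m n m≢n with m ≡ᵇ n in e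
... | true = contradiction (≡ᵇ-true⇒≡ m n e) m≢n
... | false = refl

eqTy-refl : ∀ s → eqTy s s ≡ true
eqTy-refl ω = refl
eqTy-refl (ty k) = ≡ᵇ-refl k

eqTy-sym : ∀ s s' → eqTy s s' ≡ eqTy s' s
eqTy-sym ω ω = refl
eqTy-sym ω (ty _) = refl
eqTy-sym (ty _) ω = refl
eqTy-sym (ty k) (ty l) = ≡ᵇ-sym k l

eqVar-refl : ∀ s i → eqVar s i s i ≡ true
eqVar-refl s i rewrite eqTy-refl s | ≡ᵇ-refl i = refl

eqVar-sym : ∀ s i s' j → eqVar s i s' j ≡ eqVar s' j s i
eqVar-sym s i s' j rewrite eqTy-sym s s' | ≡ᵇ-sym i j = refl

eqVar⇒≡ : ∀ s i s' j → eqVar s i s' j ≡ true → i ≡ j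
eqVar⇒≡ s i s' j e = ≡ᵇ-true⇒≡ i j (∧-conicalʳ _ _ e)

occursFree-All-self : ∀ s i A → occursFree s i (All s i A) ≡ false
occursFree-All-self s i A rewrite eqVar-refl s i = refl

occursFree-Ex-self : ∀ s i A → occursFree s i (Ex s i A) ≡ false
occursFree-Ex-self s i A rewrite eqVar-refl s i = refl

occursFree-¬¬ : ∀ s i A → occursFree s i (¬f ¬f A) ≡ occursFree s i A
occursFree-¬¬ s i A = trans (∨-identityʳ _) (∨-identityʳ _)

occursFree-¬¬Ex-self : ∀ s i A → occursFree s i (¬f ¬f Ex s i A) ≡ false
occursFree-¬¬Ex-self s i A = trans (occursFree-¬¬ s i (Ex s i A)) (occursFree-Ex-self s i A)

substT-self : ∀ s i {s'} (a : Term s') → substT s i (var i) a ≡ a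
substT-self s i {s'} (var j) with s ≟T s'
... | no _ = refl
... | yes refl with j ≡ᵇ i in e
...   | true = cong var (sym (≡ᵇ-true⇒≡ j i e))
...   | false = refl
substT-self s i (cst _) = refl
substT-self s i zer = refl

sub-self : ∀ s i φ → sub s i (var i) φ ≡ φ
sub-self s i (Ap a b c) rewrite substT-self s i a | substT-self s i b | substT-self s i c = refl
sub-self s i (EqN a b) rewrite substT-self s i a | substT-self s i b = refl
sub-self s i (EqK k a b) rewrite substT-self s i a | substT-self s i b = refl
sub-self s i (Mem k a b) rewrite substT-self s i a | substT-self s i b = refl
sub-self s i ⊥f = refl
sub-self s i (φ ∧f ψ) = cong₂ _∧f_ (sub-self s i φ) (sub-self s i ψ)
sub-self s i (φ ∨f ψ) = cong₂ _∨f_ (sub-self s i φ) (sub-self s i ψ)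
sub-self s i (φ ⇒ ψ) = cong₂ _⇒_ (sub-self s i φ) (sub-self s i ψ)
sub-self s i (All s' j φ) with eqVar s i s' j
... | true = refl
... | false = cong (All s' j) (sub-self s i φ)
sub-self s i (Ex s' j φ) with eqVar s i s' j
... | true = refl
... | false = cong (Ex s' j) (sub-self s i φ)

freeFor-self : ∀ s i φ → freeFor s i (var i) φ ≡ true
freeFor-self s i (Ap _ _ _) = refl
freeFor-self s i (EqN _ _) = refl
freeFor-self s i (EqK _ _ _) = refl
freeFor-self s i (Mem _ _ _) = refl
freeFor-self s i ⊥f = refl
freeFor-self s i (φ ∧f ψ) = cong₂ _∧_ (freeFor-self s i φ) (freeFor-self s i ψ)
freeFor-self s i (φ ∨f ψ) = cong₂ _∧_ (freeFor-self s i φ) (freeFor-self s i ψ)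
freeFor-self s i (φ ⇒ ψ) = cong₂ _∧_ (freeFor-self s i φ) (freeFor-self s i ψ)
freeFor-self s i (All s' j φ) with eqVar s i s' j in e
... | true = refl
... | false rewrite eqVar-sym s' j s i | e | ∧-zeroʳ (occursFree s i φ) | freeFor-self s i φ = refl
freeFor-self s i (Ex s' j φ) with eqVar s i s' j in e
... | true = refl
... | false rewrite eqVar-sym s' j s i | e | ∧-zeroʳ (occursFree s i φ) | freeFor-self s i φ = refl

module _ {Γ : Formula} {s : Ty} {i : ℕ} {A : Formula} where

  ∀E-self : Γ ⊩ All s i A → Γ ⊩ A
  ∀E-self p = subst (Γ ⊩_) (sub-self s i A) (∀E (var i) (freeFor-self s i A) p)

  ∃I-self : Γ ⊩ A → Γ ⊩ Ex s i A
  ∃I-self p = ∃I (var i) (freeFor-self s i A) (subst (Γ ⊩_) (sym (sub-self s i A)) p)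

substT-notFree : ∀ s i (t : Term s) {s'} (a : Term s') → termIs s i a ≡ false → substT s i t a ≡ a
substT-notFree s i t {s'} (var j) e with s ≟T s'
... | no _ = refl
... | yes refl rewrite eqTy-refl s | ≡ᵇ-sym j i | e = refl
substT-notFree s i t (cst _) e = refl
substT-notFree s i t zer e = refl

sub-notFree : ∀ s i (t : Term s) φ → occursFree s i φ ≡ false → sub s i t φ ≡ φ
sub-notFree s i t (Ap a b c) e
  rewrite substT-notFree s i t a (∨-conicalˡ _ _ e)
        | substT-notFree s i t b (∨-conicalˡ _ _ (∨-conicalʳ (termIs s i a) _ e))
        | substT-notFree s i t c (∨-conicalʳ (termIs s i b) _ (∨-conicalʳ (termIs s i a) _ e)) = refl
sub-notFree s i t (EqN a b) e
  rewrite substT-notFree s i t a (∨-conicalˡ _ _ e) | substT-notFree s i t b (∨-conicalʳ _ _ e) = refl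
sub-notFree s i t (EqK k a b) e
  rewrite substT-notFree s i t a (∨-conicalˡ _ _ e) | substT-notFree s i t b (∨-conicalʳ _ _ e) = refl
sub-notFree s i t (Mem k a b) e
  rewrite substT-notFree s i t a (∨-conicalˡ _ _ e) | substT-notFree s i t b (∨-conicalʳ _ _ e) = refl
sub-notFree s i t ⊥f e = refl
sub-notFree s i t (φ ∧f ψ) e =
  cong₂ _∧f_ (sub-notFree s i t φ (∨-conicalˡ _ _ e)) (sub-notFree s i t ψ (∨-conicalʳ _ _ e))
sub-notFree s i t (φ ∨f ψ) e =
  cong₂ _∨f_ (sub-notFree s i t φ (∨-conicalˡ _ _ e)) (sub-notFree s i t ψ (∨-conicalʳ _ _ e))
sub-notFree s i t (φ ⇒ ψ) e =
  cong₂ _⇒_ (sub-notFree s i t φ (∨-conicalˡ _ _ e)) (sub-notFree s i t ψ (∨-conicalʳ _ _ e))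
sub-notFree s i t (All s' j φ) e with eqVar s i s' j
... | true = refl
... | false = cong (All s' j) (sub-notFree s i t φ e)
sub-notFree s i t (Ex s' j φ) e with eqVar s i s' j
... | true = refl
... | false = cong (Ex s' j) (sub-notFree s i t φ e)

termIs-substT : ∀ s j s' i (t : Term s') {s''} (a : Term s'') →
                termIs s j a ≡ false → termIs s j t ≡ false → termIs s j (substT s' i t a) ≡ false
termIs-substT s j s' i t {s''} (var k) ea et with s' ≟T s''
... | no _ = ea
... | yes refl with k ≡ᵇ i
...   | true = et
...   | false = ea
termIs-substT s j s' i t (cst _) ea et = refl
termIs-substT s j s' i t zer ea et = refl

occursFree-sub : ∀ s j s' i (t : Term s') φ → occursFree s j φ ≡ false → termIs s j t ≡ false →
                 occursFree s j (sub s' i t φ) ≡ false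
occursFree-sub s j s' i t (Ap a b c) e et =
  cong₂ _∨_ (termIs-substT s j s' i t a (∨-conicalˡ _ _ e) et)
    (cong₂ _∨_ (termIs-substT s j s' i t b (∨-conicalˡ _ _ (∨-conicalʳ (termIs s j a) _ e)) et)
               (termIs-substT s j s' i t c (∨-conicalʳ (termIs s j b) _ (∨-conicalʳ (termIs s j a) _ e)) et))
occursFree-sub s j s' i t (EqN a b) e et =
  cong₂ _∨_ (termIs-substT s j s' i t a (∨-conicalˡ _ _ e) et) (termIs-substT s j s' i t b (∨-conicalʳ _ _ e) et)
occursFree-sub s j s' i t (EqK k a b) e et =
  cong₂ _∨_ (termIs-substT s j s' i t a (∨-conicalˡ _ _ e) et) (termIs-substT s j s' i t b (∨-conicalʳ _ _ e) et)
occursFree-sub s j s' i t (Mem k a b) e et =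
  cong₂ _∨_ (termIs-substT s j s' i t a (∨-conicalˡ _ _ e) et) (termIs-substT s j s' i t b (∨-conicalʳ _ _ e) et)
occursFree-sub s j s' i t ⊥f e et = refl
occursFree-sub s j s' i t (φ ∧f ψ) e et =
  cong₂ _∨_ (occursFree-sub s j s' i t φ (∨-conicalˡ _ _ e) et) (occursFree-sub s j s' i t ψ (∨-conicalʳ _ _ e) et)
occursFree-sub s j s' i t (φ ∨f ψ) e et =
  cong₂ _∨_ (occursFree-sub s j s' i t φ (∨-conicalˡ _ _ e) et) (occursFree-sub s j s' i t ψ (∨-conicalʳ _ _ e) et)
occursFree-sub s j s' i t (φ ⇒ ψ) e et =
  cong₂ _∨_ (occursFree-sub s j s' i t φ (∨-conicalˡ _ _ e) et) (occursFree-sub s j s' i t ψ (∨-conicalʳ _ _ e) et)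
occursFree-sub s j s' i t (All s'' k φ) e et with eqVar s' i s'' k
... | true = e
... | false with eqVar s j s'' k
...   | true = refl
...   | false = occursFree-sub s j s' i t φ e et
occursFree-sub s j s' i t (Ex s'' k φ) e et with eqVar s' i s'' k
... | true = e
... | false with eqVar s j s'' k
...   | true = refl
...   | false = occursFree-sub s j s' i t φ e et

bindsNum : ℕ → Formula → Bool
bindsNum j (φ ∧f ψ) = bindsNum j φ ∨ bindsNum j ψ
bindsNum j (φ ∨f ψ) = bindsNum j φ ∨ bindsNum j ψ
bindsNum j (φ ⇒ ψ) = bindsNum j φ ∨ bindsNum j ψ
bindsNum j (All s k φ) = eqVar ω j s k ∨ bindsNum j φ
bindsNum j (Ex s k φ) = eqVar ω j s k ∨ bindsNum j φ
bindsNum j _ = false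

bindsNum-sub : ∀ j s i (t : Term s) φ → bindsNum j (sub s i t φ) ≡ bindsNum j φ
bindsNum-sub j s i t (Ap _ _ _) = refl
bindsNum-sub j s i t (EqN _ _) = refl
bindsNum-sub j s i t (EqK _ _ _) = refl
bindsNum-sub j s i t (Mem _ _ _) = refl
bindsNum-sub j s i t ⊥f = refl
bindsNum-sub j s i t (φ ∧f ψ) = cong₂ _∨_ (bindsNum-sub j s i t φ) (bindsNum-sub j s i t ψ)
bindsNum-sub j s i t (φ ∨f ψ) = cong₂ _∨_ (bindsNum-sub j s i t φ) (bindsNum-sub j s i t ψ)
bindsNum-sub j s i t (φ ⇒ ψ) = cong₂ _∨_ (bindsNum-sub j s i t φ) (bindsNum-sub j s i t ψ)
bindsNum-sub j s i t (All s' k φ) with eqVar s i s' k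
... | true = refl
... | false = cong (eqVar ω j s' k ∨_) (bindsNum-sub j s i t φ)
bindsNum-sub j s i t (Ex s' k φ) with eqVar s i s' k
... | true = refl
... | false = cong (eqVar ω j s' k ∨_) (bindsNum-sub j s i t φ)

uncaptured : ∀ a {b} c → b ≡ false → (not (a ∧ b) ∧ c) ≡ c
uncaptured a c refl rewrite ∧-zeroʳ a = refl

freeFor-unbound : ∀ j i φ → bindsNum j φ ≡ false → freeFor ω i (var {ω} j) φ ≡ true
freeFor-unbound j i (Ap _ _ _) e = refl
freeFor-unbound j i (EqN _ _) e = refl
freeFor-unbound j i (EqK _ _ _) e = refl
freeFor-unbound j i (Mem _ _ _) e = refl
freeFor-unbound j i ⊥f e = refl
freeFor-unbound j i (φ ∧f ψ) e =
  cong₂ _∧_ (freeFor-unbound j i φ (∨-conicalˡ _ _ e)) (freeFor-unbound j i ψ (∨-conicalʳ _ _ e))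
freeFor-unbound j i (φ ∨f ψ) e =
  cong₂ _∧_ (freeFor-unbound j i φ (∨-conicalˡ _ _ e)) (freeFor-unbound j i ψ (∨-conicalʳ _ _ e))
freeFor-unbound j i (φ ⇒ ψ) e =
  cong₂ _∧_ (freeFor-unbound j i φ (∨-conicalˡ _ _ e)) (freeFor-unbound j i ψ (∨-conicalʳ _ _ e))
freeFor-unbound j i (All s k φ) e with eqVar ω i s k
... | true = refl
... | false = trans (uncaptured (occursFree ω i φ) _ (trans (eqVar-sym s k ω j) (∨-conicalˡ _ _ e)))
                   (freeFor-unbound j i φ (∨-conicalʳ _ _ e))
freeFor-unbound j i (Ex s k φ) e with eqVar ω i s k
... | true = refl
... | false = trans (uncaptured (occursFree ω i φ) _ (trans (eqVar-sym s k ω j) (∨-conicalˡ _ _ e)))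
                   (freeFor-unbound j i φ (∨-conicalʳ _ _ e))

maxNumT : ∀ {s} → Term s → ℕ
maxNumT {ω} (var j) = j
maxNumT _ = 0

maxNumBinder : Ty → ℕ → ℕ
maxNumBinder ω k = k
maxNumBinder (ty _) k = 0

maxNum : Formula → ℕ
maxNum (Ap a b c) = maxNumT a ⊔ maxNumT b ⊔ maxNumT c
maxNum (EqN a b) = maxNumT a ⊔ maxNumT b
maxNum (EqK _ a b) = maxNumT a ⊔ maxNumT b
maxNum (Mem _ a b) = maxNumT a ⊔ maxNumT b
maxNum ⊥f = 0
maxNum (φ ∧f ψ) = maxNum φ ⊔ maxNum ψ
maxNum (φ ∨f ψ) = maxNum φ ⊔ maxNum ψ
maxNum (φ ⇒ ψ) = maxNum φ ⊔ maxNum ψ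
maxNum (All s k φ) = maxNumBinder s k ⊔ maxNum φ
maxNum (Ex s k φ) = maxNumBinder s k ⊔ maxNum φ

<⇒≡ᵇ-false : ∀ {k j} → k < j → (j ≡ᵇ k) ≡ false
<⇒≡ᵇ-false {k} {j} k<j = ≢⇒≡ᵇ-false j k (>⇒≢ k<j)

fresh-termIs : ∀ j {s} (a : Term s) → maxNumT a < j → termIs ω j a ≡ false
fresh-termIs j {ω} (var k) k<j = <⇒≡ᵇ-false k<j
fresh-termIs j {ty _} (var k) _ = refl
fresh-termIs j (cst _) _ = refl
fresh-termIs j zer _ = refl

fresh-eqVar : ∀ j s k → maxNumBinder s k < j → eqVar ω j s k ≡ false
fresh-eqVar j ω k k<j = <⇒≡ᵇ-false k<j
fresh-eqVar j (ty _) k _ = refl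

fresh-occursFree : ∀ j φ → maxNum φ < j → occursFree ω j φ ≡ false
fresh-occursFree j (Ap a b c) lt =
  cong₂ _∨_ (fresh-termIs j a (m⊔n<o⇒m<o _ _ ab<j))
    (cong₂ _∨_ (fresh-termIs j b (m⊔n<o⇒n<o (maxNumT a) _ ab<j)) (fresh-termIs j c (m⊔n<o⇒n<o _ _ lt)))
  where
  ab<j : maxNumT a ⊔ maxNumT b < j
  ab<j = m⊔n<o⇒m<o (maxNumT a ⊔ maxNumT b) (maxNumT c) lt
fresh-occursFree j (EqN a b) lt =
  cong₂ _∨_ (fresh-termIs j a (m⊔n<o⇒m<o _ _ lt)) (fresh-termIs j b (m⊔n<o⇒n<o _ _ lt))
fresh-occursFree j (EqK _ a b) lt =
  cong₂ _∨_ (fresh-termIs j a (m⊔n<o⇒m<o _ _ lt)) (fresh-termIs j b (m⊔n<o⇒n<o _ _ lt))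
fresh-occursFree j (Mem _ a b) lt =
  cong₂ _∨_ (fresh-termIs j a (m⊔n<o⇒m<o _ _ lt)) (fresh-termIs j b (m⊔n<o⇒n<o _ _ lt))
fresh-occursFree j ⊥f lt = refl
fresh-occursFree j (φ ∧f ψ) lt =
  cong₂ _∨_ (fresh-occursFree j φ (m⊔n<o⇒m<o _ _ lt)) (fresh-occursFree j ψ (m⊔n<o⇒n<o _ _ lt))
fresh-occursFree j (φ ∨f ψ) lt =
  cong₂ _∨_ (fresh-occursFree j φ (m⊔n<o⇒m<o _ _ lt)) (fresh-occursFree j ψ (m⊔n<o⇒n<o _ _ lt))
fresh-occursFree j (φ ⇒ ψ) lt =
  cong₂ _∨_ (fresh-occursFree j φ (m⊔n<o⇒m<o _ _ lt)) (fresh-occursFree j ψ (m⊔n<o⇒n<o _ _ lt))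
fresh-occursFree j (All s k φ) lt
  rewrite fresh-eqVar j s k (m⊔n<o⇒m<o _ _ lt) = fresh-occursFree j φ (m⊔n<o⇒n<o _ _ lt)
fresh-occursFree j (Ex s k φ) lt
  rewrite fresh-eqVar j s k (m⊔n<o⇒m<o _ _ lt) = fresh-occursFree j φ (m⊔n<o⇒n<o _ _ lt)

fresh-bindsNum : ∀ j φ → maxNum φ < j → bindsNum j φ ≡ false
fresh-bindsNum j (Ap a b c) lt = refl
fresh-bindsNum j (EqN a b) lt = refl
fresh-bindsNum j (EqK _ a b) lt = refl
fresh-bindsNum j (Mem _ a b) lt = refl
fresh-bindsNum j ⊥f lt = refl
fresh-bindsNum j (φ ∧f ψ) lt =
  cong₂ _∨_ (fresh-bindsNum j φ (m⊔n<o⇒m<o _ _ lt)) (fresh-bindsNum j ψ (m⊔n<o⇒n<o _ _ lt))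
fresh-bindsNum j (φ ∨f ψ) lt =
  cong₂ _∨_ (fresh-bindsNum j φ (m⊔n<o⇒m<o _ _ lt)) (fresh-bindsNum j ψ (m⊔n<o⇒n<o _ _ lt))
fresh-bindsNum j (φ ⇒ ψ) lt =
  cong₂ _∨_ (fresh-bindsNum j φ (m⊔n<o⇒m<o _ _ lt)) (fresh-bindsNum j ψ (m⊔n<o⇒n<o _ _ lt))
fresh-bindsNum j (All s k φ) lt =
  cong₂ _∨_ (fresh-eqVar j s k (m⊔n<o⇒m<o _ _ lt)) (fresh-bindsNum j φ (m⊔n<o⇒n<o _ _ lt))
fresh-bindsNum j (Ex s k φ) lt =
  cong₂ _∨_ (fresh-eqVar j s k (m⊔n<o⇒m<o _ _ lt)) (fresh-bindsNum j φ (m⊔n<o⇒n<o _ _ lt))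

substT-substT-var : ∀ n m (t : Term ω) {s'} (a : Term s') → n ≢ m → termIs ω m a ≡ false →
                    substT ω m t (substT ω n (var m) a) ≡ substT ω n t a
substT-substT-var n m t {s'} (var k) n≢m e with ω ≟T s'
... | no ω≢s' with ω ≟T s'
...   | no _ = refl
...   | yes ω≡s' = contradiction ω≡s' ω≢s'
substT-substT-var n m t {s'} (var k) n≢m e | yes refl with k ≡ᵇ n
... | true rewrite ≡ᵇ-refl m = refl
... | false rewrite ≡ᵇ-sym k m | e = refl
substT-substT-var n m t (cst _) n≢m e = refl
substT-substT-var n m t zer n≢m e = refl

-- If  t  is free for  x  in  Q y φ  and  t = y , then  x  is not free in  φ .
captured⇒notFree : ∀ a b c → (not (a ∧ b) ∧ c) ≡ true → b ≡ true → a ≡ false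
captured⇒notFree false b c _ _ = refl
captured⇒notFree true true c () refl

sub-captured : ∀ n m (t : Term ω) s j φ →
               (not (occursFree ω n φ ∧ termIs s j (var {ω} m)) ∧ freeFor ω n (var m) φ) ≡ true →
               eqVar ω m s j ≡ true → sub ω n (var m) φ ≡ sub ω n t φ
sub-captured n m t s j φ f m≡j = trans (sub-notFree ω n (var m) φ n∉φ) (sym (sub-notFree ω n t φ n∉φ))
  where
  n∉φ : occursFree ω n φ ≡ false
  n∉φ = captured⇒notFree (occursFree ω n φ) _ _ f (trans (eqVar-sym s j ω m) m≡j)

sub-sub-var : ∀ n m (t : Term ω) φ → n ≢ m → occursFree ω m φ ≡ false →
              freeFor ω n (var m) φ ≡ true → sub ω m t (sub ω n (var m) φ) ≡ sub ω n t φ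
sub-sub-var n m t (Ap a b c) n≢m o _
  rewrite substT-substT-var n m t a n≢m (∨-conicalˡ _ _ o)
        | substT-substT-var n m t b n≢m (∨-conicalˡ _ _ (∨-conicalʳ (termIs ω m a) _ o))
        | substT-substT-var n m t c n≢m (∨-conicalʳ (termIs ω m b) _ (∨-conicalʳ (termIs ω m a) _ o)) = refl
sub-sub-var n m t (EqN a b) n≢m o _
  rewrite substT-substT-var n m t a n≢m (∨-conicalˡ _ _ o) | substT-substT-var n m t b n≢m (∨-conicalʳ _ _ o) = refl
sub-sub-var n m t (EqK k a b) n≢m o _
  rewrite substT-substT-var n m t a n≢m (∨-conicalˡ _ _ o) | substT-substT-var n m t b n≢m (∨-conicalʳ _ _ o) = refl
sub-sub-var n m t (Mem k a b) n≢m o _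
  rewrite substT-substT-var n m t a n≢m (∨-conicalˡ _ _ o) | substT-substT-var n m t b n≢m (∨-conicalʳ _ _ o) = refl
sub-sub-var n m t ⊥f n≢m o _ = refl
sub-sub-var n m t (φ ∧f ψ) n≢m o f =
  cong₂ _∧f_ (sub-sub-var n m t φ n≢m (∨-conicalˡ _ _ o) (∧-conicalˡ _ _ f))
             (sub-sub-var n m t ψ n≢m (∨-conicalʳ _ _ o) (∧-conicalʳ _ _ f))
sub-sub-var n m t (φ ∨f ψ) n≢m o f =
  cong₂ _∨f_ (sub-sub-var n m t φ n≢m (∨-conicalˡ _ _ o) (∧-conicalˡ _ _ f))
             (sub-sub-var n m t ψ n≢m (∨-conicalʳ _ _ o) (∧-conicalʳ _ _ f))
sub-sub-var n m t (φ ⇒ ψ) n≢m o f =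
  cong₂ _⇒_ (sub-sub-var n m t φ n≢m (∨-conicalˡ _ _ o) (∧-conicalˡ _ _ f))
            (sub-sub-var n m t ψ n≢m (∨-conicalʳ _ _ o) (∧-conicalʳ _ _ f))
sub-sub-var n m t (All s j φ) n≢m o f with eqVar ω n s j in n≡j
... | true with eqVar ω m s j in m≡j
...   | true = contradiction (trans (eqVar⇒≡ ω n s j n≡j) (sym (eqVar⇒≡ ω m s j m≡j))) n≢m
...   | false = cong (All s j) (sub-notFree ω m t φ o)
sub-sub-var n m t (All s j φ) n≢m o f | false with eqVar ω m s j in m≡j
...   | true = cong (All s j) (sub-captured n m t s j φ f m≡j)
...   | false = cong (All s j) (sub-sub-var n m t φ n≢m o (∧-conicalʳ _ _ f))
sub-sub-var n m t (Ex s j φ) n≢m o f with eqVar ω n s j in n≡j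
... | true with eqVar ω m s j in m≡j
...   | true = contradiction (trans (eqVar⇒≡ ω n s j n≡j) (sym (eqVar⇒≡ ω m s j m≡j))) n≢m
...   | false = cong (Ex s j) (sub-notFree ω m t φ o)
sub-sub-var n m t (Ex s j φ) n≢m o f | false with eqVar ω m s j in m≡j
...   | true = cong (Ex s j) (sub-captured n m t s j φ f m≡j)
...   | false = cong (Ex s j) (sub-sub-var n m t φ n≢m o (∧-conicalʳ _ _ f))

-- The translation and substitution

termIs-trT : ∀ g s i {s'} (a : Term s') → termIs s i (trT g a) ≡ termIs s i a
termIs-trT g s i (var j) = refl
termIs-trT g s i (cst K) = refl
termIs-trT g s i (cst S) = refl
termIs-trT g s i (cst D) = refl
termIs-trT g s i (cst P) = refl
termIs-trT g s i (cst P₁) = refl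
termIs-trT g s i (cst P₂) = refl
termIs-trT g s i (cst (C _)) = refl
termIs-trT g s i zer = refl

occursFree-negF : ∀ g s i φ → occursFree s i (negF g φ) ≡ occursFree s i φ
occursFree-negF g s i (Ap a b c)
  rewrite termIs-trT g s i a | termIs-trT g s i b | termIs-trT g s i c = occursFree-¬¬ s i (Ap a b c)
occursFree-negF g s i (EqN a b)
  rewrite termIs-trT g s i a | termIs-trT g s i b = occursFree-¬¬ s i (EqN a b)
occursFree-negF g s i (EqK k a b)
  rewrite termIs-trT g s i a | termIs-trT g s i b = occursFree-¬¬ s i (EqK k a b)
occursFree-negF g s i (Mem k a b)
  rewrite termIs-trT g s i a | termIs-trT g s i b = occursFree-¬¬ s i (Mem k a b)
occursFree-negF g s i ⊥f = refl
occursFree-negF g s i (φ ∧f ψ) = cong₂ _∨_ (occursFree-negF g s i φ) (occursFree-negF g s i ψ)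
occursFree-negF g s i (φ ∨f ψ) =
  trans (occursFree-¬¬ s i (negF g φ ∨f negF g ψ)) (cong₂ _∨_ (occursFree-negF g s i φ) (occursFree-negF g s i ψ))
occursFree-negF g s i (φ ⇒ ψ) = cong₂ _∨_ (occursFree-negF g s i φ) (occursFree-negF g s i ψ)
occursFree-negF g s i (All s' j φ) = cong (not (eqVar s i s' j) ∧_) (occursFree-negF g s i φ)
occursFree-negF g s i (Ex s' j φ) =
  trans (occursFree-¬¬ s i (Ex s' j (negF g φ))) (cong (not (eqVar s i s' j) ∧_) (occursFree-negF g s i φ))

substT-trT : ∀ g s i (t : Term s) {s'} (a : Term s') →
             substT s i (trT g t) (trT g a) ≡ trT g (substT s i t a)
substT-trT g s i t {s'} (var j) with s ≟T s'
... | no _ = refl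
... | yes refl with j ≡ᵇ i
...   | true = refl
...   | false = refl
substT-trT g s i t (cst K) = refl
substT-trT g s i t (cst S) = refl
substT-trT g s i t (cst D) = refl
substT-trT g s i t (cst P) = refl
substT-trT g s i t (cst P₁) = refl
substT-trT g s i t (cst P₂) = refl
substT-trT g s i t (cst (C _)) = refl
substT-trT g s i t zer = refl

negF-sub : ∀ g s i (t : Term s) φ → negF g (sub s i t φ) ≡ sub s i (trT g t) (negF g φ)
negF-sub g s i t (Ap a b c)
  rewrite substT-trT g s i t a | substT-trT g s i t b | substT-trT g s i t c = refl
negF-sub g s i t (EqN a b) rewrite substT-trT g s i t a | substT-trT g s i t b = refl
negF-sub g s i t (EqK k a b) rewrite substT-trT g s i t a | substT-trT g s i t b = refl
negF-sub g s i t (Mem k a b) rewrite substT-trT g s i t a | substT-trT g s i t b = refl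
negF-sub g s i t ⊥f = refl
negF-sub g s i t (φ ∧f ψ) = cong₂ _∧f_ (negF-sub g s i t φ) (negF-sub g s i t ψ)
negF-sub g s i t (φ ∨f ψ) rewrite negF-sub g s i t φ | negF-sub g s i t ψ = refl
negF-sub g s i t (φ ⇒ ψ) = cong₂ _⇒_ (negF-sub g s i t φ) (negF-sub g s i t ψ)
negF-sub g s i t (All s' j φ) with eqVar s i s' j
... | true = refl
... | false = cong (All s' j) (negF-sub g s i t φ)
negF-sub g s i t (Ex s' j φ) with eqVar s i s' j
... | true = refl
... | false rewrite negF-sub g s i t φ = refl

freeFor-negF : ∀ g s i (t : Term s) φ → freeFor s i (trT g t) (negF g φ) ≡ freeFor s i t φ
freeFor-negF g s i t (Ap _ _ _) = refl
freeFor-negF g s i t (EqN _ _) = refl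
freeFor-negF g s i t (EqK _ _ _) = refl
freeFor-negF g s i t (Mem _ _ _) = refl
freeFor-negF g s i t ⊥f = refl
freeFor-negF g s i t (φ ∧f ψ) = cong₂ _∧_ (freeFor-negF g s i t φ) (freeFor-negF g s i t ψ)
freeFor-negF g s i t (φ ∨f ψ) rewrite freeFor-negF g s i t φ | freeFor-negF g s i t ψ =
  trans (∧-identityʳ _) (∧-identityʳ _)
freeFor-negF g s i t (φ ⇒ ψ) = cong₂ _∧_ (freeFor-negF g s i t φ) (freeFor-negF g s i t ψ)
freeFor-negF g s i t (All s' j φ)
  rewrite freeFor-negF g s i t φ | occursFree-negF g s i φ | termIs-trT g s' j t = refl
freeFor-negF g s i t (Ex s' j φ)
  rewrite freeFor-negF g s i t φ | occursFree-negF g s i φ | termIs-trT g s' j t =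
  trans (∧-identityʳ _) (∧-identityʳ _)

elementary-negF : ∀ g n φ → elementary n (negF g φ) ≡ elementary n φ
elementary-negF g n (Ap _ _ _) = refl
elementary-negF g n (EqN _ _) = refl
elementary-negF g n (EqK k _ _) = trans (∧-identityʳ _) (∧-identityʳ _)
elementary-negF g n (Mem k _ _) = trans (∧-identityʳ _) (∧-identityʳ _)
elementary-negF g n ⊥f = refl
elementary-negF g n (φ ∧f ψ) = cong₂ _∧_ (elementary-negF g n φ) (elementary-negF g n ψ)
elementary-negF g n (φ ∨f ψ) rewrite elementary-negF g n φ | elementary-negF g n ψ =
  trans (∧-identityʳ _) (∧-identityʳ _)
elementary-negF g n (φ ⇒ ψ) = cong₂ _∧_ (elementary-negF g n φ) (elementary-negF g n ψ)
elementary-negF g n (All s j φ) = cong ((s <T n) ∧_) (elementary-negF g n φ)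
elementary-negF g n (Ex s j φ) rewrite elementary-negF g n φ = trans (∧-identityʳ _) (∧-identityʳ _)

All-stable : ∀ {s i A} → Stable A → Stable (All s i A)
All-stable {s} {i} {A} A-stable =
  close (lam (ru-∀ (trans (occursFree-¬¬ s i (All s i A)) (occursFree-All-self s i A))
    (app (pure A-stable) (lam (app v₁ (lam (app v₁ (∀E-self v₀))))))))

negF-stable : ∀ g φ → Stable (negF g φ)
negF-stable g (Ap _ _ _) = ¬-stable
negF-stable g (EqN _ _) = ¬-stable
negF-stable g (EqK _ _ _) = ¬-stable
negF-stable g (Mem _ _ _) = ¬-stable
negF-stable g ⊥f = ⊥-stable
negF-stable g (φ ∧f ψ) = ∧-stable (negF-stable g φ) (negF-stable g ψ)
negF-stable g (φ ∨f ψ) = ¬-stable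
negF-stable g (φ ⇒ ψ) = ⇒-stable (negF-stable g ψ)
negF-stable g (All s i φ) = All-stable (negF-stable g φ)
negF-stable g (Ex s i φ) = ¬-stable

-- For a positive formula A (built from atoms and ⊥ by ∧, ∨, ∃) the translation
-- negF g A is intuitionistically equivalent to ¬¬ trF g A.
isPositive : Formula → Bool
isPositive (Ap _ _ _) = true
isPositive (EqN _ _) = true
isPositive (EqK _ _ _) = true
isPositive (Mem _ _ _) = true
isPositive ⊥f = true
isPositive (A ∧f B) = isPositive A ∧ isPositive B
isPositive (A ∨f B) = isPositive A ∧ isPositive B
isPositive (A ⇒ B) = false
isPositive (All _ _ _) = false
isPositive (Ex _ _ A) = isPositive A

trF : (ℕ → ℕ) → Formula → Formula
trF g (Ap a b c) = Ap (trT g a) (trT g b) (trT g c)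
trF g (EqN a b) = EqN (trT g a) (trT g b)
trF g (EqK k a b) = EqK k (trT g a) (trT g b)
trF g (Mem k a b) = Mem k (trT g a) (trT g b)
trF g ⊥f = ⊥f
trF g (A ∧f B) = trF g A ∧f trF g B
trF g (A ∨f B) = trF g A ∨f trF g B
trF g (A ⇒ B) = trF g A ⇒ trF g B
trF g (All s i A) = All s i (trF g A)
trF g (Ex s i A) = Ex s i (trF g A)

trF⇒negF : ∀ g A → isPositive A ≡ true → ⊢ trF g A ⇒ negF g A
negF⇒¬¬trF : ∀ g A → isPositive A ≡ true → ⊢ negF g A ⇒ ¬f ¬f trF g A

trF⇒negF g (Ap _ _ _) _ = close (lam (¬¬I v₀))
trF⇒negF g (EqN _ _) _ = close (lam (¬¬I v₀))
trF⇒negF g (EqK _ _ _) _ = close (lam (¬¬I v₀))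
trF⇒negF g (Mem _ _ _) _ = close (lam (¬¬I v₀))
trF⇒negF g ⊥f _ = ⇒-refl ⊥f
trF⇒negF g (A ∧f B) e =
  close (lam (pair (app (pure (trF⇒negF g A (∧-conicalˡ _ _ e))) (fst v₀))
                   (app (pure (trF⇒negF g B (∧-conicalʳ _ _ e))) (snd v₀))))
trF⇒negF g (A ∨f B) e =
  close (lam (¬¬I (case∨ v₀ (inl (app (pure (trF⇒negF g A (∧-conicalˡ _ _ e))) v₀))
                             (inr (app (pure (trF⇒negF g B (∧-conicalʳ _ _ e))) v₀)))))
trF⇒negF g (Ex s i A) e =
  close (lam (∃E (occursFree-Ex-self s i (trF g A)) (occursFree-¬¬Ex-self s i (negF g A))
                 v₀ (¬¬I (∃I-self (app (pure (trF⇒negF g A e)) v₀)))))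

negF⇒¬¬trF g (Ap _ _ _) _ = ⇒-refl _
negF⇒¬¬trF g (EqN _ _) _ = ⇒-refl _
negF⇒¬¬trF g (EqK _ _ _) _ = ⇒-refl _
negF⇒¬¬trF g (Mem _ _ _) _ = ⇒-refl _
negF⇒¬¬trF g ⊥f _ = close (lam (¬¬I v₀))
negF⇒¬¬trF g (A ∧f B) e =
  close (lam (¬¬bind (app (pure (negF⇒¬¬trF g A (∧-conicalˡ _ _ e))) (fst v₀))
               (¬¬bind (app (pure (negF⇒¬¬trF g B (∧-conicalʳ _ _ e))) (snd v₁))
                 (¬¬I (pair v₁ v₀)))))
negF⇒¬¬trF g (A ∨f B) e =
  close (lam (¬¬bind v₀ (case∨ v₀
     (¬¬bind (app (pure (negF⇒¬¬trF g A (∧-conicalˡ _ _ e))) v₀) (¬¬I (inl v₀)))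
     (¬¬bind (app (pure (negF⇒¬¬trF g B (∧-conicalʳ _ _ e))) v₀) (¬¬I (inr v₀))))))
negF⇒¬¬trF g (Ex s i A) e =
  close (lam (¬¬bind v₀
    (∃E (cong₂ _∨_ (occursFree-¬¬Ex-self s i (negF g A)) (occursFree-Ex-self s i (negF g A)))
        (occursFree-¬¬Ex-self s i (trF g A))
        v₀ (¬¬bind (app (pure (negF⇒¬¬trF g A e)) v₀) (¬¬I (∃I-self v₀))))))

positive-⇒-negF : ∀ g A B → isPositive A ≡ true → isPositive B ≡ true →
                  ⊢ trF g A ⇒ trF g B → ⊢ negF g A ⇒ negF g B
positive-⇒-negF g A B A⁺ B⁺ p =
  close (lam (app (pure (negF-stable g B))
    (¬¬bind (app (pure (negF⇒¬¬trF g A A⁺)) v₀) (¬¬I (app (pure (⇒-trans p (trF⇒negF g B B⁺))) v₀)))))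

positive-All⇔-negF : ∀ g s i A B → isPositive A ≡ true → isPositive B ≡ true →
                     ⊢ All s i (trF g A ⇔ trF g B) → ⊢ negF g (All s i (A ⇔ B))
positive-All⇔-negF g s i A B A⁺ B⁺ p =
  gen s i (close (pair (pure (positive-⇒-negF g A B A⁺ B⁺ (close (fst (pure A⇔B)))))
                       (pure (positive-⇒-negF g B A B⁺ A⁺ (close (snd (pure A⇔B)))))))
  where
  A⇔B : ⊢ trF g A ⇔ trF g B
  A⇔B = close (∀E-self (pure p))

-- Gödel numbers

bitValue : Bool → ℕ
bitValue b = if b then 1 else 0

length<num : ∀ bs → length bs < num bs
length<num [] = s≤s z≤n
length<num (b ∷ bs) = begin-strict
  suc (length bs)         ≤⟨ length<num bs ⟩
  num bs                  <⟨ m<m+n (num bs) (≤-<-trans z≤n (length<num bs)) ⟩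
  num bs + num bs         ≡⟨ cong (num bs +_) (sym (+-identityʳ (num bs))) ⟩
  2 * num bs              ≤⟨ m≤n+m _ (bitValue b) ⟩
  bitValue b + 2 * num bs ∎
  where open ≤-Reasoning

num-∷-/2 : ∀ b y → (bitValue b + 2 * y) / 2 ≡ y
num-∷-/2 b y = begin
  (bitValue b + 2 * y) / 2           ≡⟨ cong (λ v → (bitValue b + v) / 2) (*-comm 2 y) ⟩
  (bitValue b + y * 2) / 2           ≡⟨ +-distrib-/ (bitValue b) (y * 2) (no-carry b) ⟩
  bitValue b / 2 + y * 2 / 2         ≡⟨ cong₂ _+_ (bit/2 b) (m*n/n≡m y 2) ⟩
  y                                  ∎
  where
  open ≡-Reasoning
  no-carry : ∀ b → bitValue b % 2 + y * 2 % 2 < 2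
  no-carry b = subst (λ r → bitValue b % 2 + r < 2) (sym (m*n%n≡0 y 2)) (bit<2 b)
    where
    bit<2 : ∀ b → bitValue b % 2 + 0 < 2
    bit<2 true = s≤s (s≤s z≤n)
    bit<2 false = s≤s z≤n
  bit/2 : ∀ b → bitValue b / 2 ≡ 0
  bit/2 true = refl
  bit/2 false = refl

num-∷-%2 : ∀ b y → ((bitValue b + 2 * y) % 2 ≡ᵇ 1) ≡ b
num-∷-%2 b y = begin
  ((bitValue b + 2 * y) % 2 ≡ᵇ 1) ≡⟨ cong (λ v → (bitValue b + v) % 2 ≡ᵇ 1) (*-comm 2 y) ⟩
  ((bitValue b + y * 2) % 2 ≡ᵇ 1) ≡⟨ cong (_≡ᵇ 1) ([m+kn]%n≡m%n (bitValue b) y 2) ⟩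
  (bitValue b % 2 ≡ᵇ 1)           ≡⟨ bit b ⟩
  b                               ∎
  where
  open ≡-Reasoning
  bit : ∀ b → (bitValue b % 2 ≡ᵇ 1) ≡ b
  bit true = refl
  bit false = refl

num-∷≰1 : ∀ b bs → (num (b ∷ bs) ≤ᵇ 1) ≡ false
num-∷≰1 b bs with num (b ∷ bs) | length<num (b ∷ bs)
... | suc zero | s≤s ()
... | suc (suc _) | _ = refl

bitsOf-num : ∀ f bs → length bs ≤ f → bitsOf f (num bs) ≡ bs
bitsOf-num zero [] _ = refl
bitsOf-num (suc f) [] _ = refl
bitsOf-num (suc f) (b ∷ bs) (s≤s bs≤f)
  rewrite num-∷≰1 b bs | num-∷-%2 b (num bs) | num-∷-/2 b (num bs) = cong (b ∷_) (bitsOf-num f bs bs≤f)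

group-replicate : ∀ a c r → group a (replicate c true ++ (false ∷ r)) ≡ (a + c) ∷ group 0 r
group-replicate a zero r = cong (_∷ group 0 r) (sym (+-identityʳ a))
group-replicate a (suc c) r = trans (group-replicate (suc a) c r) (cong (_∷ group 0 r) (sym (+-suc a c)))

group-toBits : ∀ L → group 0 (toBits L) ≡ L
group-toBits [] = refl
group-toBits (x ∷ L) rewrite ++-assoc (replicate x true) (false ∷ []) (toBits L) =
  trans (group-replicate 0 x (toBits L)) (cong (x ∷_) (group-toBits L))

sum≤length-toBits : ∀ L → sum L ≤ length (toBits L)
sum≤length-toBits [] = z≤n
sum≤length-toBits (x ∷ L)
  rewrite ++-assoc (replicate x true) (false ∷ []) (toBits L)
        | length-++ (replicate x true) {false ∷ toBits L} | length-replicate x {true} =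
  +-monoʳ-≤ x (≤-trans (sum≤length-toBits L) (n≤1+n _))

decTy-encTy : ∀ s → decTy (encTy s) ≡ s
decTy-encTy ω = refl
decTy-encTy (ty k) = refl

parseT-encT : ∀ s (t : Term s) r → parseT s (encT t ++ r) ≡ just (t , r)
parseT-encT ω (var i) r = refl
parseT-encT (ty zero) (var i) r = refl
parseT-encT (ty (suc k)) (var i) r = refl
parseT-encT .(ty 0) (cst K) r = refl
parseT-encT .(ty 0) (cst S) r = refl
parseT-encT .(ty 0) (cst D) r = refl
parseT-encT .(ty 0) (cst P) r = refl
parseT-encT .(ty 0) (cst P₁) r = refl
parseT-encT .(ty 0) (cst P₂) r = refl
parseT-encT .(ty 0) (cst (C _)) r = refl
parseT-encT .ω zer r = refl

depth : Formula → ℕ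
depth (A ∧f B) = suc (depth A ⊔ depth B)
depth (A ∨f B) = suc (depth A ⊔ depth B)
depth (A ⇒ B) = suc (depth A ⊔ depth B)
depth (All _ _ A) = suc (depth A)
depth (Ex _ _ A) = suc (depth A)
depth _ = 1

parseF-encF : ∀ f φ r → depth φ ≤ f → parseF f (encF φ ++ r) ≡ just (φ , r)
parseF-encF (suc f) (Ap a b c) r _
  rewrite ++-assoc (encT a) (encT b ++ encT c) r | ++-assoc (encT b) (encT c) r
        | parseT-encT (ty 0) a (encT b ++ encT c ++ r) | parseT-encT (ty 0) b (encT c ++ r)
        | parseT-encT (ty 0) c r = refl
parseF-encF (suc f) (EqN a b) r _
  rewrite ++-assoc (encT a) (encT b) r | parseT-encT (ty 0) a (encT b ++ r) | parseT-encT ω b r = refl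
parseF-encF (suc f) (EqK k a b) r _
  rewrite ++-assoc (encT a) (encT b) r | parseT-encT (ty 0) a (encT b ++ r) | parseT-encT (ty k) b r = refl
parseF-encF (suc f) (Mem k a b) r _
  rewrite ++-assoc (encT a) (encT b) r | parseT-encT (ty k) a (encT b ++ r)
        | parseT-encT (ty (suc k)) b r = refl
parseF-encF (suc f) ⊥f r _ = refl
parseF-encF (suc f) (A ∧f B) r (s≤s d≤f)
  rewrite ++-assoc (encF A) (encF B) r
        | parseF-encF f A (encF B ++ r) (m⊔n≤o⇒m≤o _ _ d≤f) | parseF-encF f B r (m⊔n≤o⇒n≤o _ _ d≤f) = refl
parseF-encF (suc f) (A ∨f B) r (s≤s d≤f)
  rewrite ++-assoc (encF A) (encF B) r
        | parseF-encF f A (encF B ++ r) (m⊔n≤o⇒m≤o _ _ d≤f) | parseF-encF f B r (m⊔n≤o⇒n≤o _ _ d≤f) = refl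
parseF-encF (suc f) (A ⇒ B) r (s≤s d≤f)
  rewrite ++-assoc (encF A) (encF B) r
        | parseF-encF f A (encF B ++ r) (m⊔n≤o⇒m≤o _ _ d≤f) | parseF-encF f B r (m⊔n≤o⇒n≤o _ _ d≤f) = refl
parseF-encF (suc f) (All s i A) r (s≤s d≤f) rewrite parseF-encF f A r d≤f | decTy-encTy s = refl
parseF-encF (suc f) (Ex s i A) r (s≤s d≤f) rewrite parseF-encF f A r d≤f | decTy-encTy s = refl

depth≤length-encF : ∀ φ → depth φ ≤ length (encF φ)
depth⊔≤length-encF-++ : ∀ A B → depth A ⊔ depth B ≤ length (encF A ++ encF B)

depth≤length-encF (Ap a b c) = s≤s z≤n
depth≤length-encF (EqN a b) = s≤s z≤n
depth≤length-encF (EqK k a b) = s≤s z≤n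
depth≤length-encF (Mem k a b) = s≤s z≤n
depth≤length-encF ⊥f = s≤s z≤n
depth≤length-encF (A ∧f B) = s≤s (depth⊔≤length-encF-++ A B)
depth≤length-encF (A ∨f B) = s≤s (depth⊔≤length-encF-++ A B)
depth≤length-encF (A ⇒ B) = s≤s (depth⊔≤length-encF-++ A B)
depth≤length-encF (All s i A) = s≤s (≤-trans (depth≤length-encF A) (≤-trans (n≤1+n _) (n≤1+n _)))
depth≤length-encF (Ex s i A) = s≤s (≤-trans (depth≤length-encF A) (≤-trans (n≤1+n _) (n≤1+n _)))

depth⊔≤length-encF-++ A B rewrite length-++ (encF A) {encF B} =
  ⊔-lub (≤-trans (depth≤length-encF A) (m≤m+n _ _)) (≤-trans (depth≤length-encF B) (m≤n+m _ _))

parseVars-encVars : ∀ xs r → parseVars (length xs) (encVars xs ++ r) ≡ just (xs , r)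
parseVars-encVars [] r = refl
parseVars-encVars ((s , i) ∷ xs) r rewrite parseVars-encVars xs r | decTy-encTy s = refl

parseTriple-encTriple : ∀ k z xs φ → parseTriple (encTriple k z xs φ) ≡ just (k , z , xs , φ)
parseTriple-encTriple k z xs φ
  rewrite parseVars-encVars xs (encF φ)
        | subst (λ L → parseF (length (encF φ)) L ≡ just (φ , []))
                (++-identityʳ (encF φ)) (parseF-encF (length (encF φ)) φ [] (depth≤length-encF φ)) = refl

decode-code : ∀ k z xs φ → decode (code k z xs φ) ≡ just (k , z , xs , φ)
decode-code k z xs φ
  rewrite bitsOf-num (code k z xs φ) (toBits (encTriple k z xs φ)) (<⇒≤ (length<num (toBits (encTriple k z xs φ))))
        | group-toBits (encTriple k z xs φ) | parseTriple-encTriple k z xs φ | ≡ᵇ-refl (code k z xs φ) = refl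

decode≡just⇒code : ∀ n {k z xs φ} → decode n ≡ just (k , z , xs , φ) → code k z xs φ ≡ n
decode≡just⇒code n e with parseTriple (group 0 (bitsOf n n))
decode≡just⇒code n () | nothing
... | just (k , z , xs , φ) with code k z xs φ ≡ᵇ n in code≡n
decode≡just⇒code n refl | just _ | true = ≡ᵇ-true⇒≡ _ _ code≡n
decode≡just⇒code n () | just _ | false

AllConstsT : (ℕ → Set) → ∀ {s} → Term s → Set
AllConstsT Q (cst (C c)) = Q c
AllConstsT Q _ = ⊤

AllConsts : (ℕ → Set) → Formula → Set
AllConsts Q (Ap a b c) = AllConstsT Q a × AllConstsT Q b × AllConstsT Q c
AllConsts Q (EqN a b) = AllConstsT Q a × AllConstsT Q b
AllConsts Q (EqK k a b) = AllConstsT Q a × AllConstsT Q b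
AllConsts Q (Mem k a b) = AllConstsT Q a × AllConstsT Q b
AllConsts Q ⊥f = ⊤
AllConsts Q (A ∧f B) = AllConsts Q A × AllConsts Q B
AllConsts Q (A ∨f B) = AllConsts Q A × AllConsts Q B
AllConsts Q (A ⇒ B) = AllConsts Q A × AllConsts Q B
AllConsts Q (All _ _ A) = AllConsts Q A
AllConsts Q (Ex _ _ A) = AllConsts Q A

AllConstsT-map : ∀ {Q R : ℕ → Set} → (∀ {c} → Q c → R c) →
                 ∀ {s} (t : Term s) → AllConstsT Q t → AllConstsT R t
AllConstsT-map f (var _) _ = tt
AllConstsT-map f (cst K) _ = tt
AllConstsT-map f (cst S) _ = tt
AllConstsT-map f (cst D) _ = tt
AllConstsT-map f (cst P) _ = tt
AllConstsT-map f (cst P₁) _ = tt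
AllConstsT-map f (cst P₂) _ = tt
AllConstsT-map f (cst (C _)) q = f q
AllConstsT-map f zer _ = tt

AllConsts-map : ∀ {Q R : ℕ → Set} → (∀ {c} → Q c → R c) → ∀ φ → AllConsts Q φ → AllConsts R φ
AllConsts-map f (Ap a b c) (qa , qb , qc) = AllConstsT-map f a qa , AllConstsT-map f b qb , AllConstsT-map f c qc
AllConsts-map f (EqN a b) (qa , qb) = AllConstsT-map f a qa , AllConstsT-map f b qb
AllConsts-map f (EqK k a b) (qa , qb) = AllConstsT-map f a qa , AllConstsT-map f b qb
AllConsts-map f (Mem k a b) (qa , qb) = AllConstsT-map f a qa , AllConstsT-map f b qb
AllConsts-map f ⊥f _ = tt
AllConsts-map f (A ∧f B) (qA , qB) = AllConsts-map f A qA , AllConsts-map f B qB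
AllConsts-map f (A ∨f B) (qA , qB) = AllConsts-map f A qA , AllConsts-map f B qB
AllConsts-map f (A ⇒ B) (qA , qB) = AllConsts-map f A qA , AllConsts-map f B qB
AllConsts-map f (All _ _ A) qA = AllConsts-map f A qA
AllConsts-map f (Ex _ _ A) qA = AllConsts-map f A qA

trT-cong : ∀ g h {s} (t : Term s) → AllConstsT (λ c → g c ≡ h c) t → trT g t ≡ trT h t
trT-cong g h (var _) _ = refl
trT-cong g h (cst K) _ = refl
trT-cong g h (cst S) _ = refl
trT-cong g h (cst D) _ = refl
trT-cong g h (cst P) _ = refl
trT-cong g h (cst P₁) _ = refl
trT-cong g h (cst P₂) _ = refl
trT-cong g h (cst (C _)) e = cong (cst ∘ C) e
trT-cong g h zer _ = refl

negF-cong : ∀ g h φ → AllConsts (λ c → g c ≡ h c) φ → negF g φ ≡ negF h φ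
negF-cong g h (Ap a b c) (ea , eb , ec)
  rewrite trT-cong g h a ea | trT-cong g h b eb | trT-cong g h c ec = refl
negF-cong g h (EqN a b) (ea , eb) rewrite trT-cong g h a ea | trT-cong g h b eb = refl
negF-cong g h (EqK k a b) (ea , eb) rewrite trT-cong g h a ea | trT-cong g h b eb = refl
negF-cong g h (Mem k a b) (ea , eb) rewrite trT-cong g h a ea | trT-cong g h b eb = refl
negF-cong g h ⊥f _ = refl
negF-cong g h (A ∧f B) (eA , eB) = cong₂ _∧f_ (negF-cong g h A eA) (negF-cong g h B eB)
negF-cong g h (A ∨f B) (eA , eB) rewrite negF-cong g h A eA | negF-cong g h B eB = refl
negF-cong g h (A ⇒ B) (eA , eB) = cong₂ _⇒_ (negF-cong g h A eA) (negF-cong g h B eB)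
negF-cong g h (All s i A) eA = cong (All s i) (negF-cong g h A eA)
negF-cong g h (Ex s i A) eA rewrite negF-cong g h A eA = refl

consts∈encT : ∀ {s} (t : Term s) → AllConstsT (_∈ encT t) t
consts∈encT (var _) = tt
consts∈encT (cst K) = tt
consts∈encT (cst S) = tt
consts∈encT (cst D) = tt
consts∈encT (cst P) = tt
consts∈encT (cst P₁) = tt
consts∈encT (cst P₂) = tt
consts∈encT (cst (C _)) = there (here refl)
consts∈encT zer = tt

consts∈encF : ∀ φ → AllConsts (_∈ encF φ) φ
consts∈encF (Ap a b c) =
  AllConstsT-map (there ∘ ∈-++⁺ˡ) a (consts∈encT a) ,
  AllConstsT-map (there ∘ ∈-++⁺ʳ (encT a) ∘ ∈-++⁺ˡ) b (consts∈encT b) ,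
  AllConstsT-map (there ∘ ∈-++⁺ʳ (encT a) ∘ ∈-++⁺ʳ (encT b)) c (consts∈encT c)
consts∈encF (EqN a b) =
  AllConstsT-map (there ∘ ∈-++⁺ˡ) a (consts∈encT a) , AllConstsT-map (there ∘ ∈-++⁺ʳ (encT a)) b (consts∈encT b)
consts∈encF (EqK k a b) =
  AllConstsT-map (there ∘ there ∘ ∈-++⁺ˡ) a (consts∈encT a) ,
  AllConstsT-map (there ∘ there ∘ ∈-++⁺ʳ (encT a)) b (consts∈encT b)
consts∈encF (Mem k a b) =
  AllConstsT-map (there ∘ there ∘ ∈-++⁺ˡ) a (consts∈encT a) ,
  AllConstsT-map (there ∘ there ∘ ∈-++⁺ʳ (encT a)) b (consts∈encT b)
consts∈encF ⊥f = tt
consts∈encF (A ∧f B) =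
  AllConsts-map (there ∘ ∈-++⁺ˡ) A (consts∈encF A) , AllConsts-map (there ∘ ∈-++⁺ʳ (encF A)) B (consts∈encF B)
consts∈encF (A ∨f B) =
  AllConsts-map (there ∘ ∈-++⁺ˡ) A (consts∈encF A) , AllConsts-map (there ∘ ∈-++⁺ʳ (encF A)) B (consts∈encF B)
consts∈encF (A ⇒ B) =
  AllConsts-map (there ∘ ∈-++⁺ˡ) A (consts∈encF A) , AllConsts-map (there ∘ ∈-++⁺ʳ (encF A)) B (consts∈encF B)
consts∈encF (All s i A) = AllConsts-map (there ∘ there ∘ there) A (consts∈encF A)
consts∈encF (Ex s i A) = AllConsts-map (there ∘ there ∘ there) A (consts∈encF A)

∈⇒≤sum : ∀ {m L} → m ∈ L → m ≤ sum L
∈⇒≤sum (here refl) = m≤m+n _ _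
∈⇒≤sum {L = x ∷ L} (there m∈L) = ≤-trans (∈⇒≤sum m∈L) (m≤n+m _ x)

consts<code : ∀ k z xs φ → AllConsts (_< code k z xs φ) φ
consts<code k z xs φ = AllConsts-map c<code φ (consts∈encF φ)
  where
  L : List ℕ
  L = encTriple k z xs φ
  c<code : ∀ {c} → c ∈ encF φ → c < code k z xs φ
  c<code c∈φ = ≤-<-trans (≤-trans (∈⇒≤sum {L = L} (there (there (there (∈-++⁺ʳ (encVars xs) c∈φ)))))
                                   (sum≤length-toBits L))
                         (length<num (toBits L))

-- The recursion only visits codes of constants of the decoded formula, all below m.
negIdxF-fuel : ∀ m → Acc _<_ m → ∀ f → m < f → negIdxF f m ≡ negIdx m
negIdxF-fuel m (acc rs) (suc f) (s≤s m≤f) with decode m in decoded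
... | nothing = refl
... | just (k , z , xs , φ) = cong (code k z xs) (negF-cong (negIdxF f) (negIdxF m) φ
      (AllConsts-map agree φ
        (subst (λ n → AllConsts (_< n) φ) (decode≡just⇒code m decoded) (consts<code k z xs φ))))
  where
  agree : ∀ {c} → c < m → negIdxF f c ≡ negIdxF m c
  agree c<m = trans (negIdxF-fuel _ (rs c<m) f (≤-trans c<m m≤f)) (sym (negIdxF-fuel _ (rs c<m) m c<m))

negIdx-code : ∀ k z xs φ → negIdx (code k z xs φ) ≡ code k z xs (neg φ)
negIdx-code k z xs φ rewrite decode-code k z xs φ =
  cong (code k z xs) (negF-cong (negIdxF (code k z xs φ)) negIdx φ
    (AllConsts-map (λ {c} c<n → negIdxF-fuel c (<-wellFounded c) (code k z xs φ) c<n) φ (consts<code k z xs φ)))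

-- Comprehension

trE : (ℕ → ℕ) → ETerm → ETerm
trE g (tm s t) = tm s (trT g t)
trE g (a · b) = trE g a · trE g b

maxV0-trE : ∀ g t → maxV0 (trE g t) ≡ maxV0 t
maxV0-trE g (tm ω t) = refl
maxV0-trE g (tm (ty zero) (var _)) = refl
maxV0-trE g (tm (ty zero) (cst K)) = refl
maxV0-trE g (tm (ty zero) (cst S)) = refl
maxV0-trE g (tm (ty zero) (cst D)) = refl
maxV0-trE g (tm (ty zero) (cst P)) = refl
maxV0-trE g (tm (ty zero) (cst P₁)) = refl
maxV0-trE g (tm (ty zero) (cst P₂)) = refl
maxV0-trE g (tm (ty zero) (cst (C _))) = refl
maxV0-trE g (tm (ty (suc k)) (var _)) = refl
maxV0-trE g (a · b) = cong₂ _⊔_ (maxV0-trE g a) (maxV0-trE g b)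

trF-≃₀ : ∀ g t x → trF g (t ≃₀ x) ≡ (trE g t ≃₀ x)
trF-≃₀ g (tm ω t) x = refl
trF-≃₀ g (tm (ty k) t) x = refl
trF-≃₀ g (a · b) x
  rewrite maxV0-trE g a | maxV0-trE g b
        | trF-≃₀ g a (suc (maxV0 a ⊔ maxV0 b ⊔ x)) | trF-≃₀ g b (suc (suc (maxV0 a ⊔ maxV0 b ⊔ x))) = refl

≃₀-positive : ∀ t x → isPositive (t ≃₀ x) ≡ true
≃₀-positive (tm ω t) x = refl
≃₀-positive (tm (ty k) t) x = refl
≃₀-positive (a · b) x
  rewrite ≃₀-positive a (suc (maxV0 a ⊔ maxV0 b ⊔ x)) | ≃₀-positive b (suc (suc (maxV0 a ⊔ maxV0 b ⊔ x))) = refl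

varTerm : Ty × ℕ → ETerm
varTerm (s , i) = tm s (var i)

trE-tuple : ∀ g a r → trE g (tuple a r) ≡ tuple (trE g a) (map (trE g) r)
trE-tuple g a [] = refl
trE-tuple g a (b ∷ r) = trE-tuple g (tm (ty 0) (cst P) · a · b) r

trE-varTerms : ∀ g xs → map (trE g) (map varTerm xs) ≡ map varTerm xs
trE-varTerms g [] = refl
trE-varTerms g (x ∷ xs) = cong (varTerm x ∷_) (trE-varTerms g xs)

trE-appArgs : ∀ g c xs → trE g (appArgs (ec (C c)) (map varTerm xs)) ≡ appArgs (ec (C (g c))) (map varTerm xs)
trE-appArgs g c [] = refl
trE-appArgs g c (x ∷ xs) rewrite trE-tuple g (varTerm x) (map varTerm xs) | trE-varTerms g xs = refl

comprTerm≃ : ℕ → ℕ → ℕ → List (Ty × ℕ) → Formula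
comprTerm≃ k u c xs = appArgs (ec (C c)) (map varTerm xs) ≃ tm (ty (suc k)) (var u)

trF-comprTerm≃ : ∀ g k u c xs → trF g (comprTerm≃ k u c xs) ≡ comprTerm≃ k u (g c) xs
trF-comprTerm≃ g k u c xs
  rewrite trF-≃₀ g (appArgs (ec (C c)) (map varTerm xs))
                   (fresh (appArgs (ec (C c)) (map varTerm xs)) (tm (ty (suc k)) (var u)))
        | trE-appArgs g c xs
        | trans (sym (maxV0-trE g (appArgs (ec (C c)) (map varTerm xs)))) (cong maxV0 (trE-appArgs g c xs)) = refl

comprTerm≃-positive : ∀ k u c xs → isPositive (comprTerm≃ k u c xs) ≡ true
comprTerm≃-positive k u c xs
  rewrite ≃₀-positive (appArgs (ec (C c)) (map varTerm xs))
                      (fresh (appArgs (ec (C c)) (map varTerm xs)) (tm (ty (suc k)) (var u))) = refl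

All⇔-¬¬ˡ : ∀ s z M A → Stable A → ⊢ All s z (M ⇔ A) ⇒ All s z ((¬f ¬f M ⇒ A) ∧f (A ⇒ ¬f ¬f M))
All⇔-¬¬ˡ s z M A A-stable = close (lam (ru-∀ (occursFree-All-self s z (M ⇔ A))
  (pair (lam (¬¬E A-stable v₀ (app (fst (∀E-self v₂)) v₀)))
        (lam (¬¬I (app (snd (∀E-self v₁)) v₀))))))

Comprehends : ℕ → ℕ → ℕ → Formula → Formula
Comprehends k z u ψ = All (ty k) z (Mem k (var z) (var u) ⇔ ψ)

comprehension-negF : ∀ k z xs φ u →
  ⊢ Ex (ty (suc k)) u (comprTerm≃ k u (code k z xs (neg φ)) xs ∧f Comprehends k z u (neg φ)) →
  ⊢ neg (Ex (ty (suc k)) u (comprTerm≃ k u (code k z xs φ) xs ∧f Comprehends k z u φ))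
comprehension-negF k z xs φ u instance⁻ =
  mp (subst (λ i → ⊢ Ex U u (comprTerm≃ k u i xs ∧f Comprehends k z u (neg φ))) (sym (negIdx-code k z xs φ)) instance⁻)
     (close (lam (∃E (occursFree-Ex-self U u (comprTerm≃ k u (negIdx c) xs ∧f Comprehends k z u (neg φ)))
                     (occursFree-¬¬Ex-self U u (neg (comprTerm≃ k u c xs ∧f Comprehends k z u φ))) v₀
       (¬¬I (∃I-self (pair (app (pure comprTerm≃⇒negF) (fst v₀))
                           (app (pure (All⇔-¬¬ˡ (ty k) z _ _ (negF-stable negIdx φ))) (snd v₀))))))))
  where
  U : Ty
  U = ty (suc k)
  c : ℕ
  c = code k z xs φ
  comprTerm≃⇒negF : ⊢ comprTerm≃ k u (negIdx c) xs ⇒ neg (comprTerm≃ k u c xs)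
  comprTerm≃⇒negF = subst (λ A → ⊢ A ⇒ neg (comprTerm≃ k u c xs)) (trF-comprTerm≃ negIdx k u c xs)
                          (trF⇒negF negIdx (comprTerm≃ k u c xs) (comprTerm≃-positive k u c xs))

-- BT has no equality of numerical variables; SameNum a b says that m_a and m_b
-- are named by the same type-0 objects.
SameNum : ℕ → ℕ → Formula
SameNum a b = All (ty 0) 0 (EqN (var 0) (var a) ⇒ EqN (var 0) (var b)) ∧f
              All (ty 0) 0 (EqN (var 0) (var b) ⇒ EqN (var 0) (var a))

SameNum-sym : ∀ a b → ⊢ SameNum a b ⇒ SameNum b a
SameNum-sym a b = close (lam (pair (snd v₀) (fst v₀)))

occursFree-SameNum : ∀ s j a b → eqVar s j ω a ≡ false → eqVar s j ω b ≡ false →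
                     occursFree s j (SameNum a b) ≡ false
occursFree-SameNum s j a b j≢a j≢b rewrite j≢a | j≢b with eqVar s j (ty 0) 0
... | true = refl
... | false = refl

substT-num-ty : ∀ n (t : Term ω) {k} (x : Term (ty k)) → substT ω n t x ≡ x
substT-num-ty n t (var _) = refl
substT-num-ty n t (cst _) = refl

not-∧-true⇒false : ∀ a c → (not a ∧ c) ≡ true → a ≡ false
not-∧-true⇒false false c _ = refl

⇒-const-id : ∀ {A B} → ⊢ A ⇒ B ⇒ B
⇒-const-id = close (lam (lam v₀))

SameNum-subst : ∀ n φ a b → freeFor ω n (var a) φ ≡ true → freeFor ω n (var b) φ ≡ true →
                ⊢ SameNum a b ⇒ sub ω n (var a) φ ⇒ sub ω n (var b) φ
SameNum-subst n (Ap x y z) a b _ _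
  rewrite substT-num-ty n (var a) x | substT-num-ty n (var a) y | substT-num-ty n (var a) z
        | substT-num-ty n (var b) x | substT-num-ty n (var b) y | substT-num-ty n (var b) z = ⇒-const-id
SameNum-subst n (EqN x (var j)) a b _ _ rewrite substT-num-ty n (var a) x | substT-num-ty n (var b) x with j ≡ᵇ n
... | true = close (lam (lam (app (∀E x refl (fst v₁)) v₀)))
... | false = ⇒-const-id
SameNum-subst n (EqN x zer) a b _ _ rewrite substT-num-ty n (var a) x | substT-num-ty n (var b) x = ⇒-const-id
SameNum-subst n (EqK k x y) a b _ _
  rewrite substT-num-ty n (var a) x | substT-num-ty n (var a) y
        | substT-num-ty n (var b) x | substT-num-ty n (var b) y = ⇒-const-id
SameNum-subst n (Mem k x y) a b _ _
  rewrite substT-num-ty n (var a) x | substT-num-ty n (var a) y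
        | substT-num-ty n (var b) x | substT-num-ty n (var b) y = ⇒-const-id
SameNum-subst n ⊥f a b _ _ = ⇒-const-id
SameNum-subst n (φ ∧f ψ) a b fa fb =
  close (lam (lam (pair (app (app (pure (SameNum-subst n φ a b (∧-conicalˡ _ _ fa) (∧-conicalˡ _ _ fb))) v₁) (fst v₀))
                        (app (app (pure (SameNum-subst n ψ a b (∧-conicalʳ _ _ fa) (∧-conicalʳ _ _ fb))) v₁) (snd v₀)))))
SameNum-subst n (φ ∨f ψ) a b fa fb =
  close (lam (lam (case∨ v₀
    (inl (app (app (pure (SameNum-subst n φ a b (∧-conicalˡ _ _ fa) (∧-conicalˡ _ _ fb))) v₂) v₀))
    (inr (app (app (pure (SameNum-subst n ψ a b (∧-conicalʳ _ _ fa) (∧-conicalʳ _ _ fb))) v₂) v₀)))))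
SameNum-subst n (φ ⇒ ψ) a b fa fb =
  close (lam (lam (lam
    (app (app (pure (SameNum-subst n ψ a b (∧-conicalʳ _ _ fa) (∧-conicalʳ _ _ fb))) v₂)
         (app v₁ (app (app (pure (SameNum-subst n φ b a (∧-conicalˡ _ _ fb) (∧-conicalˡ _ _ fa)))
                           (app (pure (SameNum-sym a b)) v₂)) v₀))))))
SameNum-subst n (All s j χ) a b fa fb with eqVar ω n s j
... | true = ⇒-const-id
... | false with occursFree ω n χ in occ
...   | false rewrite sub-notFree ω n (var a) χ occ | sub-notFree ω n (var b) χ occ = ⇒-const-id
...   | true =
  close (lam (lam (ru-∀ (cong₂ _∨_ (occursFree-SameNum s j a b (not-∧-true⇒false _ _ fa) (not-∧-true⇒false _ _ fb))
                                   (occursFree-All-self s j (sub ω n (var a) χ)))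
    (app (app (pure (SameNum-subst n χ a b (∧-conicalʳ _ _ fa) (∧-conicalʳ _ _ fb))) v₁) (∀E-self v₀)))))
SameNum-subst n (Ex s j χ) a b fa fb with eqVar ω n s j
... | true = ⇒-const-id
... | false with occursFree ω n χ in occ
...   | false rewrite sub-notFree ω n (var a) χ occ | sub-notFree ω n (var b) χ occ = ⇒-const-id
...   | true =
  close (lam (lam (∃E (cong₂ _∨_ (occursFree-SameNum s j a b (not-∧-true⇒false _ _ fa) (not-∧-true⇒false _ _ fb))
                                 (occursFree-Ex-self s j (sub ω n (var a) χ)))
                      (occursFree-Ex-self s j (sub ω n (var b) χ)) v₀
    (∃I-self (app (app (pure (SameNum-subst n χ a b (∧-conicalʳ _ _ fa) (∧-conicalʳ _ _ fb))) v₂) v₀)))))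

record Substitution : Set where
  constructor sb
  field
    sort : Ty
    name : ℕ
    term : Term sort

infix 6 _↦_ _↦ω_

_↦_ : ℕ → Term (ty 0) → Substitution
i ↦ t = sb (ty 0) i t

_↦ω_ : ℕ → Term ω → Substitution
i ↦ω t = sb ω i t

subs : List Substitution → Formula → Formula
subs [] A = A
subs (sb s i t ∷ σ) A = subs σ (sub s i t A)

freeFors : List Substitution → Formula → Bool
freeFors [] A = true
freeFors (sb s i t ∷ σ) A = freeFor s i t A ∧ freeFors σ (sub s i t A)

inst* : ∀ σ {A} → ⊢ A → freeFors σ A ≡ true → ⊢ subs σ A
inst* [] p _ = p
inst* (sb s i t ∷ σ) p e = inst* σ (inst s i t (∧-conicalˡ _ _ e) p) (∧-conicalʳ _ _ e)

-- Simultaneous substitution, as renaming to the names 100 + i followed by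
-- sequential substitution; it is correct when no term mentions a name ≥ 100.
simultaneous : List Substitution → List Substitution
simultaneous σ = map (λ { (sb s i t) → sb s i (var (100 + i)) }) σ ++ map (λ { (sb s i t) → sb s (100 + i) t }) σ

axiomInstance : ∀ {A} → Axiom A → ∀ σ → freeFors (simultaneous σ) A ≡ true → ⊢ subs (simultaneous σ) A
axiomInstance ax σ = inst* (simultaneous σ) (ax-BT ax)

=₀-refl : ∀ a → ⊢ EqK 0 (var a) (var a)
=₀-refl a = inst (ty 0) xN (var a) refl (ax-BT eq-refl)

Ex-rename : ∀ {s i j A} → occursFree s i (Ex s j (sub s i (var j) A)) ≡ false →
            freeFor s j (var i) (sub s i (var j) A) ≡ true → sub s j (var i) (sub s i (var j) A) ≡ A →
            ⊢ Ex s i A ⇒ Ex s j (sub s i (var j) A)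
Ex-rename {s} {i} {j} {A} i∉ i-free back =
  ru-∃ i∉ (subst (λ X → ⊢ X ⇒ Ex s j (sub s i (var j) A)) back (ax-∃i s j (sub s i (var j) A) (var i) i-free))

-- P m_n ≃ y_w  and  P m_n 0 ≃ y_w  unfolded, with the bound names that _≃₀_ chooses.
Pn≃ : ℕ → ℕ → Formula
Pn≃ n w = Ex (ty 0) 3 (Ex (ty 0) 4 (EqK 0 (var 3) (cst P) ∧f EqN (var 4) (var n) ∧f Ap (var 3) (var 4) (var w)))

Pn0≃ : ℕ → ℕ → Formula
Pn0≃ n w = Ex (ty 0) 2 (Ex (ty 0) 3 (Pn≃ n 2 ∧f EqN (var 3) zer ∧f Ap (var 2) (var 3) (var w)))

IsSucc : ℕ → ℕ → Formula
IsSucc n m = ec P · eN n · tm ω zer ≃ eN m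

Pn≃-functional : ∀ n → ⊢ Pn≃ n 2 ⇒ Pn≃ n 6 ⇒ EqK 0 (var 6) (var 2)
Pn≃-functional n = close (lam (lam
  (∃E refl refl v₁ (∃E refl refl v₀
  (∃E refl refl (app (pure (Ex-rename {ty 0} {3} {7} refl refl refl)) (wk (wk v₀)))
  (∃E refl refl (app (pure (Ex-rename {ty 0} {4} {8} refl refl refl)) v₀)
     (unique v₂ v₀)))))))
  where
  Body : ℕ → ℕ → ℕ → Formula
  Body a b w = EqK 0 (var a) (cst P) ∧f EqN (var b) (var n) ∧f Ap (var a) (var b) (var w)
  unique : ∀ {Γ} → Γ ⊩ Body 3 4 2 → Γ ⊩ Body 7 8 6 → Γ ⊩ EqK 0 (var 6) (var 2)
  unique {Γ} h₁ h₂ =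
    app (pure (axiomInstance ap-fun (fN ↦ var 3 ∷ xN ↦ var 4 ∷ yN ↦ var 6 ∷ zN ↦ var 2 ∷ []) refl))
        (pair Ap346 (snd (snd h₁)))
    where
    7=3 : Γ ⊩ EqK 0 (var 7) (var 3)
    7=3 = app (pure (axiomInstance (eq-sub 0 0) (uN ↦ var 3 ∷ vN ↦ var 7 ∷ XN ↦ cst P ∷ YN ↦ var 3 ∷ []) refl))
              (pair (fst h₁) (pair (fst h₂) (pure (=₀-refl 3))))
    8=4 : Γ ⊩ EqK 0 (var 8) (var 4)
    8=4 = app (pure (axiomInstance eq-num₁ (mN ↦ω var n ∷ uN ↦ var 8 ∷ vN ↦ var 4 ∷ []) refl))
              (pair (fst (snd h₂)) (fst (snd h₁)))
    Ap346 : Γ ⊩ Ap (var 3) (var 4) (var 6)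
    Ap346 = app (pure (axiomInstance eq-ap (fN ↦ var 7 ∷ xN ↦ var 8 ∷ yN ↦ var 6 ∷
                                            gN ↦ var 3 ∷ uN ↦ var 4 ∷ vN ↦ var 6 ∷ []) refl))
                (pair (snd (snd h₂)) (pair 7=3 (pair 8=4 (pure (=₀-refl 6)))))

Pn0≃-functional : ∀ n → ⊢ Pn0≃ n 1 ⇒ Pn0≃ n 5 ⇒ EqK 0 (var 5) (var 1)
Pn0≃-functional n = close (lam (lam
  (∃E refl refl v₁ (∃E refl refl v₀
  (∃E refl refl (app (pure (Ex-rename {ty 0} {2} {6} refl refl refl)) (wk (wk v₀)))
  (∃E refl refl (app (pure (Ex-rename {ty 0} {3} {7} refl refl refl)) v₀)
     (unique v₂ v₀)))))))
  where
  Body : ℕ → ℕ → ℕ → ℕ → Formula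
  Body y a b w = Pn≃ n y ∧f EqN (var b) zer ∧f Ap (var a) (var b) (var w)
  unique : ∀ {Γ} → Γ ⊩ Body 2 2 3 1 → Γ ⊩ Body 6 6 7 5 → Γ ⊩ EqK 0 (var 5) (var 1)
  unique {Γ} h₁ h₂ =
    app (pure (axiomInstance ap-fun (fN ↦ var 2 ∷ xN ↦ var 3 ∷ yN ↦ var 5 ∷ zN ↦ var 1 ∷ []) refl))
        (pair Ap235 (snd (snd h₁)))
    where
    6=2 : Γ ⊩ EqK 0 (var 6) (var 2)
    6=2 = app (app (pure (Pn≃-functional n)) (fst h₁)) (fst h₂)
    7=3 : Γ ⊩ EqK 0 (var 7) (var 3)
    7=3 = app (pure (axiomInstance eq-num₁ (mN ↦ω zer ∷ uN ↦ var 7 ∷ vN ↦ var 3 ∷ []) refl))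
              (pair (fst (snd h₂)) (fst (snd h₁)))
    Ap235 : Γ ⊩ Ap (var 2) (var 3) (var 5)
    Ap235 = app (pure (axiomInstance eq-ap (fN ↦ var 6 ∷ xN ↦ var 7 ∷ yN ↦ var 5 ∷
                                            gN ↦ var 2 ∷ uN ↦ var 3 ∷ vN ↦ var 5 ∷ []) refl))
                (pair (snd (snd h₂)) (pair 6=2 (pair 7=3 (pure (=₀-refl 5)))))

IsSucc-unique : ∀ n m m′ → ⊢ IsSucc n m ⇒ IsSucc n m′ ⇒ SameNum m m′
IsSucc-unique n m m′ =
  close (lam (lam (pair (app (app (pure (included m m′)) v₁) v₀) (app (app (pure (included m′ m)) v₀) v₁))))
  where
  included : ∀ m m′ → ⊢ IsSucc n m ⇒ IsSucc n m′ ⇒ All (ty 0) 0 (EqN (var 0) (var m) ⇒ EqN (var 0) (var m′))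
  included m m′ = close (lam (lam
    (∃E refl refl v₁
    (∃E refl refl (app (pure (Ex-rename {ty 0} {1} {5} refl refl refl)) v₁)
       (ru-∀ refl (lam (transfer v₀ v₂ v₁)))))))
    where
    transfer : ∀ {Γ} → Γ ⊩ EqN (var 0) (var m) → Γ ⊩ Pn0≃ n 1 ∧f EqN (var 1) (var m) →
               Γ ⊩ Pn0≃ n 5 ∧f EqN (var 5) (var m′) → Γ ⊩ EqN (var 0) (var m′)
    transfer {Γ} 0=m k₁ k₂ =
      app (pure (axiomInstance eq-num₂ (mN ↦ω var m′ ∷ uN ↦ var 5 ∷ vN ↦ var 0 ∷ []) refl)) (pair (snd k₂) 5=0)
      where
      5=1 : Γ ⊩ EqK 0 (var 5) (var 1)
      5=1 = app (app (pure (Pn0≃-functional n)) (fst k₁)) (fst k₂)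
      0=1 : Γ ⊩ EqK 0 (var 0) (var 1)
      0=1 = app (pure (axiomInstance eq-num₁ (mN ↦ω var m ∷ uN ↦ var 0 ∷ vN ↦ var 1 ∷ []) refl)) (pair 0=m (snd k₁))
      5=0 : Γ ⊩ EqK 0 (var 5) (var 0)
      5=0 = app (pure (axiomInstance (eq-sub 0 0) (uN ↦ var 0 ∷ vN ↦ var 5 ∷ XN ↦ var 1 ∷ YN ↦ var 0 ∷ []) refl))
                (pair 0=1 (pair 5=1 (pure (=₀-refl 0))))

IsSucc-rename : ∀ n x y → n ≢ x → n ≢ y → ⊢ Ex ω x (IsSucc n x) ⇒ Ex ω y (IsSucc n y)
IsSucc-rename n x y n≢x n≢y with x ℕ.≟ y
... | yes refl = ⇒-refl _
... | no x≢y = ru-∃ x∉ (subst (λ A → ⊢ A ⇒ Ex ω y (IsSucc n y)) renamed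
                             (ax-∃i ω y (IsSucc n y) (var x) (freeFor-unbound x y (IsSucc n y) refl)))
  where
  x∉ : occursFree ω x (Ex ω y (IsSucc n y)) ≡ false
  x∉ rewrite ≢⇒≡ᵇ-false x y x≢y | ≢⇒≡ᵇ-false x n (≢-sym n≢x) = refl
  renamed : sub ω y (var x) (IsSucc n y) ≡ IsSucc n x
  renamed rewrite ≢⇒≡ᵇ-false n y n≢y | ≡ᵇ-refl y = refl

-- The axiom p-num binds m₁, so for n = 1 its bound variable is renamed
-- before m₁ is substituted for n.
IsSucc-exists : ∀ n m → n ≢ m → ⊢ Ex ω m (IsSucc n m)
IsSucc-exists n m n≢m with n ℕ.≟ 1
... | yes refl = mp (inst ω nN (var 1) refl (mp (ax-BT p-num) (IsSucc-rename 0 1 2 (λ ()) (λ ()))))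
                    (IsSucc-rename 1 2 m (λ ()) n≢m)
... | no n≢1 = mp (inst ω nN (var n) n-free (ax-BT p-num)) (IsSucc-rename n 1 m n≢1 n≢m)
  where
  n-free : freeFor ω nN (var n) (Ex ω mN (IsSucc nN mN)) ≡ true
  n-free rewrite ≢⇒≡ᵇ-false 1 n (≢-sym n≢1) = refl

succ-step-¬¬E : ∀ n m A → n ≢ m → occursFree ω m A ≡ false → freeFor ω n (var m) A ≡ true →
                (∀ j → Stable (sub ω n (var j) A)) →
                ⊢ A ⇒ ¬f ¬f Ex ω m (neg (IsSucc n m) ∧f sub ω n (var m) A) →
                ⊢ A ⇒ Ex ω m (IsSucc n m ∧f sub ω n (var m) A)
succ-step-¬¬E n m A n≢m m∉A m-free stable step =
  close (lam (∃E m′∉A m′∉step (pure (IsSucc-exists n m′ (≢-sym m′≢n)))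
    (∃I (var m′) m′-free (subst ((⊤f ∧f A) ∧f IsSucc n m′ ⊩_) (sym renamed) (pair v₀ A[m′])))))
  where
  m′ : ℕ
  m′ = suc (maxNum A ⊔ n ⊔ m)
  A<m′ : maxNum A < m′
  A<m′ = s≤s (≤-trans (m≤m⊔n _ n) (m≤m⊔n _ m))
  m′≢n : m′ ≢ n
  m′≢n = >⇒≢ (s≤s (≤-trans (m≤n⊔m (maxNum A) n) (m≤m⊔n _ m)))
  m′≢m : m′ ≢ m
  m′≢m = >⇒≢ (s≤s (m≤n⊔m _ m))
  m′∉A : occursFree ω m′ A ≡ false
  m′∉A = fresh-occursFree m′ A A<m′
  m′-free-A : freeFor ω n (var m′) A ≡ true
  m′-free-A = freeFor-unbound m′ n A (fresh-bindsNum m′ A A<m′)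
  m′∉step : occursFree ω m′ (Ex ω m (IsSucc n m ∧f sub ω n (var m) A)) ≡ false
  m′∉step rewrite ≢⇒≡ᵇ-false m′ m m′≢m | ≢⇒≡ᵇ-false m′ n m′≢n
                | occursFree-sub ω m′ ω n (var m) A m′∉A (≢⇒≡ᵇ-false m′ m m′≢m) = refl
  m′-free : freeFor ω m (var m′) (IsSucc n m ∧f sub ω n (var m) A) ≡ true
  m′-free = freeFor-unbound m′ m (IsSucc n m ∧f sub ω n (var m) A)
              (trans (bindsNum-sub m′ ω n (var m) A) (fresh-bindsNum m′ A A<m′))
  renamed : sub ω m (var m′) (IsSucc n m ∧f sub ω n (var m) A) ≡ (IsSucc n m′ ∧f sub ω n (var m′) A)
  renamed = cong₂ _∧f_ succ-renamed (sub-sub-var n m (var m′) A n≢m m∉A m-free)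
    where
    succ-renamed : sub ω m (var m′) (IsSucc n m) ≡ IsSucc n m′
    succ-renamed rewrite ≢⇒≡ᵇ-false n m n≢m | ≡ᵇ-refl m = refl
  m∉succ′ : occursFree ω m (IsSucc n m′) ≡ false
  m∉succ′ rewrite ≢⇒≡ᵇ-false m n (≢-sym n≢m) | ≢⇒≡ᵇ-false m m′ (≢-sym m′≢m) = refl
  m∉A[m′] : occursFree ω m (sub ω n (var m′) A) ≡ false
  m∉A[m′] = occursFree-sub ω m ω n (var m′) A m∉A (≢⇒≡ᵇ-false m m′ (≢-sym m′≢m))
  A[m′] : (⊤f ∧f A) ∧f IsSucc n m′ ⊩ sub ω n (var m′) A
  A[m′] = ¬¬E (stable m′) (app (pure step) v₁)
    (∃E (cong₂ _∨_ (cong₂ _∨_ m∉A m∉succ′) (occursFree-Ex-self ω m (neg (IsSucc n m) ∧f sub ω n (var m) A)))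
        m∉A[m′] v₀
      (¬¬E (stable m′) (app (pure (negF⇒¬¬trF negIdx (IsSucc n m) refl)) (fst v₀))
        (app (app (pure (SameNum-subst n A m m′ m-free m′-free-A)) (app (app (pure (IsSucc-unique n m m′)) v₀) v₃))
             (snd v₁))))

induction-negF : ∀ n m φ → n ≢ m → occursFree ω m φ ≡ false → freeFor ω n (var m) φ ≡ true →
                 ⊢ neg (sub ω n zer φ) →
                 ⊢ neg (φ ⇒ Ex ω m (IsSucc n m ∧f sub ω n (var m) φ)) →
                 ⊢ neg φ
induction-negF n m φ n≢m m∉φ m-free base step =
  ru-ind n m (neg φ) n≢m (trans (occursFree-negF negIdx ω m φ) m∉φ) m-free⁻
    (subst ⊢_ (negF-sub negIdx ω n zer φ) base)
    (succ-step-¬¬E n m (neg φ) n≢m (trans (occursFree-negF negIdx ω m φ) m∉φ) m-free⁻ stable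
      (subst (λ B → ⊢ neg φ ⇒ ¬f ¬f Ex ω m (neg (IsSucc n m) ∧f B)) (negF-sub negIdx ω n (var m) φ) step))
  where
  m-free⁻ : freeFor ω n (var m) (neg φ) ≡ true
  m-free⁻ = trans (freeFor-negF negIdx ω n (var m) φ) m-free
  stable : ∀ j → Stable (sub ω n (var j) (neg φ))
  stable j = subst Stable (negF-sub negIdx ω n (var j) φ) (negF-stable negIdx (sub ω n (var j) φ))

-- Axioms

positive-axiom : ∀ {A} → ⊢ A → isPositive A ≡ true → trF negIdx A ≡ A → ⊢ neg A
positive-axiom {A} p A⁺ plain = mp (subst ⊢_ (sym plain) p) (trF⇒negF negIdx A A⁺)

positive-implication : ∀ {A B} → ⊢ A ⇒ B → isPositive A ≡ true → isPositive B ≡ true →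
                       trF negIdx A ≡ A → trF negIdx B ≡ B → ⊢ neg A ⇒ neg B
positive-implication {A} {B} p A⁺ B⁺ A-plain B-plain =
  positive-⇒-negF negIdx A B A⁺ B⁺ (subst ⊢_ (sym (cong₂ _⇒_ A-plain B-plain)) p)

axiom-negF : ∀ {φ} → Axiom φ → ⊢ neg φ
axiom-negF eq-refl = positive-axiom (ax-BT eq-refl) refl refl
axiom-negF (eq-sub k n) = positive-implication (ax-BT (eq-sub k n)) refl refl refl refl
axiom-negF eq-num₁ = positive-implication (ax-BT eq-num₁) refl refl refl refl
axiom-negF eq-num₂ = positive-implication (ax-BT eq-num₂) refl refl refl refl
axiom-negF eq-ap = positive-implication (ax-BT eq-ap) refl refl refl refl
axiom-negF (eq-mem zero) = positive-implication (ax-BT (eq-mem zero)) refl refl refl refl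
axiom-negF (eq-mem (suc k)) = positive-implication (ax-BT (eq-mem (suc k))) refl refl refl refl
axiom-negF ap-fun = positive-implication (ax-BT ap-fun) refl refl refl refl
axiom-negF k-ax = positive-axiom (ax-BT k-ax) refl refl
axiom-negF s-def = positive-axiom (ax-BT s-def) refl refl
axiom-negF s-ax = positive-All⇔-negF negIdx _ _ (Sxyz ≃₀ r) (xz[yz] ≃₀ r) refl refl (ax-BT s-ax)
  where
  Sxyz xz[yz] : ETerm
  Sxyz = ec S · v0 xN · v0 yN · v0 zN
  xz[yz] = v0 xN · v0 zN · (v0 yN · v0 zN)
  r : ℕ
  r = fresh Sxyz xz[yz]
axiom-negF p-def = positive-axiom (ax-BT p-def) refl refl
axiom-negF p-nz = positive-implication (ax-BT p-nz) refl refl refl refl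
axiom-negF p₁-def = positive-axiom (ax-BT p₁-def) refl refl
axiom-negF p₂-def = positive-axiom (ax-BT p₂-def) refl refl
axiom-negF p₁-ax = positive-axiom (ax-BT p₁-ax) refl refl
axiom-negF p₂-ax = positive-axiom (ax-BT p₂-ax) refl refl
axiom-negF p-num = positive-axiom (ax-BT p-num) refl refl
axiom-negF (p-ty zero) = positive-axiom (ax-BT (p-ty zero)) refl refl
axiom-negF (p-ty (suc k)) = positive-axiom (ax-BT (p-ty (suc k))) refl refl
axiom-negF d-eq = positive-implication (ax-BT d-eq) refl refl refl refl
axiom-negF d-neq =
  close (lam (app (pure (trF⇒negF negIdx (ec D · v0 xN · v0 yN · eN nN · eN mN ≃ v0 yN) refl))
                  (app (pure (ax-BT d-neq)) (lam (app v₁ (app (pure (trF⇒negF negIdx (nN =ω mN) refl)) v₀))))))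
axiom-negF num-rep = positive-axiom (ax-BT num-rep) refl refl
axiom-negF (ty-rep k) = positive-axiom (ax-BT (ty-rep k)) refl refl
axiom-negF (compr k z xs φ u xs≤k+1 φ-elem φ-params u∉xs) =
  comprehension-negF k z xs φ u
    (ax-BT (compr k z xs (neg φ) u xs≤k+1 (trans (elementary-negF negIdx (suc k) φ) φ-elem)
                  (λ s i occ → φ-params s i (trans (sym (occursFree-negF negIdx s i φ)) occ)) u∉xs))

corollary5 : (ψ : Formula) → BTcl⊢ ψ → BT⊢ neg ψ
corollary5 _ (ax-K φ ψ) = ax-K _ _
corollary5 _ (ax-S φ ψ χ) = ax-S _ _ _
corollary5 _ (ax-∧i φ ψ) = ax-∧i _ _
corollary5 _ (ax-∧e₁ φ ψ) = ax-∧e₁ _ _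
corollary5 _ (ax-∧e₂ φ ψ) = ax-∧e₂ _ _
corollary5 _ (ax-∨i₁ φ ψ) = close (lam (¬¬I (inl v₀)))
corollary5 _ (ax-∨i₂ φ ψ) = close (lam (¬¬I (inr v₀)))
corollary5 _ (ax-∨e φ ψ χ) =
  close (lam (lam (lam (¬¬E (negF-stable negIdx χ) v₀ (case∨ v₀ (app (wk v₃) v₀) (app v₃ v₀))))))
corollary5 _ (ax-efq φ) = ax-efq _
corollary5 _ (ax-∀e s i φ t t-free) rewrite negF-sub negIdx s i t φ =
  ax-∀e s i (neg φ) (trT negIdx t) (trans (freeFor-negF negIdx s i t φ) t-free)
corollary5 _ (ax-∃i s i φ t t-free) rewrite negF-sub negIdx s i t φ =
  ⇒-trans (ax-∃i s i (neg φ) (trT negIdx t) (trans (freeFor-negF negIdx s i t φ) t-free)) (close (lam (¬¬I v₀)))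
corollary5 _ (mp p q) = mp (corollary5 _ p) (corollary5 _ q)
corollary5 _ (ru-∀ {s = s} {i} {ψ = ψ} i∉ψ p) = ru-∀ (trans (occursFree-negF negIdx s i ψ) i∉ψ) (corollary5 _ p)
corollary5 _ (ru-∃ {s = s} {i} {ψ = ψ} i∉ψ p) =
  close (lam (¬¬E (negF-stable negIdx ψ) v₀
    (app (pure (ru-∃ (trans (occursFree-negF negIdx s i ψ) i∉ψ) (corollary5 _ p))) v₀)))
corollary5 _ (ax-dne φ) = negF-stable negIdx φ
corollary5 _ (ax-BT ax) = axiom-negF ax
corollary5 _ (ru-ind n m φ n≢m m∉φ m-free base step) =
  induction-negF n m φ n≢m m∉φ m-free (corollary5 _ base) (corollary5 _ step)
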